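{- The barred patterns $25\bar{1}34$ and $23\bar{1}54$ are Wilf-equivalent, i.e. $|\mathcal{S}_n(25\bar{1}34)|=|\mathcal{S}_n(23\bar{1}54)|$ for all $n\ge0$.
   Context: A barred pattern is a permutation $\sigma$ with bars over some of its letters. Let $\sigma'$ be the (reduced) classical pattern formed by the unbarred letters and $\sigma''$ the underlying permutation. A permutation $\pi$ avoids the barred pattern $\sigma$ if every occurrence of $\sigma'$ in $\pi$ (a subsequence, not necessarily consecutive, order-isomorphic to $\sigma'$) extends to an occurrence of $\sigma''$ in which the given subsequence plays the role of the unbarred letters (vacuously true if $\pi$ contains no $\sigma'$). $\mathcal{S}_n(\sigma)$ denotes the set of permutations of length $n$ avoiding $\sigma$. For example, $25\bar{1}34$ has $\sigma'=1423$ and $\sigma''=25134$. -}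

module Defs where

open import Data.Nat using (ℕ; zero; suc; _<ᵇ_; _≡ᵇ_)
open import Data.Bool using (Bool; true; false; _∧_; _∨_; not; if_then_else_)
open import Data.List using (List; []; _∷_; map; filter; length; concatMap; upTo; zip; applyUpTo)
open import Data.Bool.ListAction using (all; any)
open import Data.Product using (_,_)

_==ᴸ_ : List ℕ → List ℕ → Bool
[] ==ᴸ [] = true
(x ∷ xs) ==ᴸ (y ∷ ys) = (x ≡ᵇ y) ∧ (xs ==ᴸ ys)
_ ==ᴸ _ = false

_==ᴮ_ : Bool → Bool → Bool
true ==ᴮ b = b
false ==ᴮ b = not b

choose : ℕ → List ℕ → List (List ℕ)
choose zero xs = [] ∷ []
choose (suc k) [] = []
choose (suc k) (x ∷ xs) = map (x ∷_) (choose k xs) Data.List.++ choose (suc k) xs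

-- entry at (0-based) position i, default 0
at : List ℕ → ℕ → ℕ
at [] _ = 0
at (x ∷ xs) zero = x
at (x ∷ xs) (suc i) = at xs i

select : List ℕ → List ℕ → List ℕ
select π is = map (at π) is

keepUnbarred : List Bool → List ℕ → List ℕ
keepUnbarred [] _ = []
keepUnbarred (_ ∷ _) [] = []
keepUnbarred (b ∷ bs) (x ∷ xs) = if b then keepUnbarred bs xs else x ∷ keepUnbarred bs xs

orderIso : List ℕ → List ℕ → Bool
orderIso [] [] = true
orderIso (x ∷ xs) (y ∷ ys) =
  all (λ { (a , b) → ((x <ᵇ a) ==ᴮ (y <ᵇ b)) ∧ ((a <ᵇ x) ==ᴮ (b <ᵇ y)) }) (zip xs ys)
  ∧ orderIso xs ys
orderIso _ _ = false

-- A barred pattern: underlying permutation σ'' (a list) together with bar flags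
-- (true = barred), one flag per letter.
record BarredPattern : Set where
  constructor barred
  field
    letters : List ℕ
    bars    : List Bool
open BarredPattern public

-- π avoids the barred pattern σ: every occurrence of σ' (the unbarred letters,
-- at position tuple I) extends to an occurrence of σ'' (at position tuple J)
-- whose unbarred positions are exactly I.
avoids : BarredPattern → List ℕ → Bool
avoids σ π =
  all (λ I → not (orderIso (select π I) σ')
             ∨ any (λ J → orderIso (select π J) (letters σ) ∧ (keepUnbarred (bars σ) J ==ᴸ I))
                   (choose (length (letters σ)) pos))
      (choose (length σ') pos)
  where
    pos = upTo (length π)
    σ'  = keepUnbarred (bars σ) (letters σ)

words : ℕ → ℕ → List (List ℕ)
words n zero = [] ∷ []
words n (suc k) = concatMap (λ w → map (_∷ w) (applyUpTo suc n)) (words n k)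

distinct : List ℕ → Bool
distinct [] = true
distinct (x ∷ xs) = not (any (x ≡ᵇ_) xs) ∧ distinct xs

S : ℕ → List (List ℕ)
S n = filter (λ w → Data.Bool.T? (distinct w)) (words n n)

countAvoiders : BarredPattern → ℕ → ℕ
countAvoiders σ n = length (filter (λ π → Data.Bool.T? (avoids σ π)) (S n))

p25b134 : BarredPattern
p25b134 = barred (2 ∷ 5 ∷ 1 ∷ 3 ∷ 4 ∷ []) (false ∷ false ∷ true ∷ false ∷ false ∷ [])

p23b154 : BarredPattern
p23b154 = barred (2 ∷ 3 ∷ 1 ∷ 5 ∷ 4 ∷ []) (false ∷ false ∷ true ∷ false ∷ false ∷ [])

-- Cut a permutation at its left-to-right minima into blocks m w: the heads m decrease and each lies below every
-- entry of its block w.  In an occurrence x y z u of 2534 (resp. 2354) with no entry below x between y and z,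
-- x may be lowered to the head m of the block containing y, and then z lies in that block too.  Hence π avoids
-- 25̄134 iff no block m w, followed by the entries ρ, has y before z in w and u after z with m < z < u < y
-- (resp. m < y < u < z for 23̄154).  Writing κ x for the number of entries of ρ below x, this says that w is
-- weakly increasing in κ and each κ-class of w avoids 312 (resp. w is weakly decreasing in κ and each κ-class
-- avoids 132).  Listing the κ-classes of every block in the opposite order and complementing each class exchanges
-- the two conditions; it only permutes each block, so heads and all κ stay the same, and the opposite regrouping
-- undoes it.

module Submission where

open import Defs
open import Data.Bool using (Bool; true; false; T; T?; not; _∧_; _∨_)
open import Data.Bool.Properties using (T-∧; T-∨; T-≡)
open import Data.Bool.ListAction using (any)
open import Data.Empty using (⊥-elim)
open import Data.List using (List; []; _∷_; _++_; map; concatMap; filter; length; applyUpTo; upTo; downFrom; zip)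
open import Data.List.Membership.Propositional using (_∈_; _∉_; find; lose)
open import Data.List.Membership.Propositional.Properties
  using (∈-++⁺ˡ; ∈-++⁺ʳ; ∈-++⁻; ∈-map⁺; ∈-map⁻; ∈-filter⁺; ∈-filter⁻; ∈-concatMap⁺; ∈-concatMap⁻; ∈-upTo⁺
         ; ∈-upTo⁻; ∈-downFrom⁺; ∈-downFrom⁻)
open import Data.List.Properties
  using (∷-injectiveˡ; ∷-injectiveʳ; map-∘; map-id; length-map; length-filter; filter-accept; filter-reject
         ; filter-all; filter-none; filter-++; filter-≐; ++-assoc; ++-identityʳ; map-id-local)
open import Data.List.Relation.Unary.All as All using (All; []; _∷_)
open import Data.List.Relation.Unary.All.Properties
  using (all⁺; all⁻; gmap⁺; ++⁺; ++⁻ˡ; ++⁻ʳ) renaming (map⁺ to All-map⁺)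
open import Data.List.Relation.Unary.Any as Any using (Any; here; there)
open import Data.List.Relation.Unary.Any.Properties as Anyₚ using (any⁺; any⁻)
open import Data.List.Relation.Unary.Unique.Propositional using (Unique)
import Data.List.Relation.Unary.Unique.Propositional.Properties as Uniqueₚ
open import Data.List.Relation.Binary.Permutation.Propositional using (_↭_; ↭-refl; ↭-sym; ↭-trans; ↭-prep; ↭⇒↭ₛ)
open import Data.List.Relation.Binary.BagAndSetEquality using (∼bag⇒↭)
open import Data.List.Membership.Propositional.Properties.WithK using (unique∧set⇒bag)
open import Data.List.Relation.Binary.Permutation.Propositional.Properties
  using (↭-length; filter-↭; ∈-resp-↭; All-resp-↭; shift) renaming (++⁺ˡ to ↭-++⁺ˡ; ++⁺ to ↭-++⁺)
open import Data.List.Relation.Unary.AllPairs as AllPairs using (AllPairs; []; _∷_)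
import Data.List.Relation.Unary.AllPairs.Properties as AllPairsₚ
open import Data.List.Relation.Binary.Disjoint.Propositional using (Disjoint)
open import Data.List.Relation.Binary.Sublist.Propositional using (_⊆_; []; _∷_; _∷ʳ_)
open import Data.List.Relation.Binary.Sublist.Propositional.Properties using (Any-resp-⊆; filter-⊆)
open import Data.List.Relation.Unary.Linked as Linked using (Linked; []; [-]; _∷_)
open import Data.List.Relation.Unary.Linked.Properties as Linkedₚ using (Linked⇒All)
open import Data.Nat
  using (ℕ; zero; suc; _∸_; _≟_; _<_; _>_; _≤_; _≤?_; _<?_; _<ᵇ_; _≡ᵇ_; z≤n; s≤s; s≤s⁻¹; z<s; s<s; s<s⁻¹)
open import Data.Nat.Properties
open import Data.Product using (∃-syntax; _×_; _,_; proj₁; proj₂)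
open import Data.Sum using (_⊎_; inj₁; inj₂)
open import Data.Unit using (⊤; tt)
open import Function using (_∘_; id; _⇔_; mk⇔; Equivalence)
open import Relation.Nullary using (¬_; yes; no)
open import Relation.Binary.PropositionalEquality
open import Relation.Binary.PropositionalEquality.Properties using (setoid)
import Data.List.Relation.Binary.Permutation.Setoid.Properties (setoid ℕ) as Permₛ
open import Relation.Binary.Definitions using (tri<; tri≈; tri>)

T-not⇔¬T : ∀ {b} → T (not b) ⇔ (¬ T b)
T-not⇔¬T {true} = mk⇔ (λ ()) (λ ¬T → ¬T tt)
T-not⇔¬T {false} = mk⇔ (λ _ ()) (λ _ → tt)

==ᴮ⇒≡ : ∀ {a b} → T (a ==ᴮ b) → a ≡ b
==ᴮ⇒≡ {true} {true} _ = refl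
==ᴮ⇒≡ {false} {false} _ = refl

==ᴸ⇒≡ : ∀ xs ys → T (xs ==ᴸ ys) → xs ≡ ys
==ᴸ⇒≡ [] [] _ = refl
==ᴸ⇒≡ (x ∷ xs) (y ∷ ys) h =
  let x≡ᵇy , xs==ys = Equivalence.to T-∧ h
  in cong₂ _∷_ (≡ᵇ⇒≡ x y x≡ᵇy) (==ᴸ⇒≡ xs ys xs==ys)

≡⇒==ᴸ : ∀ xs → T (xs ==ᴸ xs)
≡⇒==ᴸ [] = tt
≡⇒==ᴸ (x ∷ xs) = Equivalence.from T-∧ (≡⇒≡ᵇ x x refl , ≡⇒==ᴸ xs)

<⇒<ᵇ≡true : ∀ {m n} → m < n → (m <ᵇ n) ≡ true
<⇒<ᵇ≡true m<n = Equivalence.to T-≡ (<⇒<ᵇ m<n)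

<ᵇ≡true⇒< : ∀ {m n} → (m <ᵇ n) ≡ true → m < n
<ᵇ≡true⇒< {m} {n} eq = <ᵇ⇒< m n (Equivalence.from T-≡ eq)

≤⇒<ᵇ≡false : ∀ {m n} → n ≤ m → (m <ᵇ n) ≡ false
≤⇒<ᵇ≡false {m} {n} n≤m with m <ᵇ n in eq
... | false = refl
... | true = ⊥-elim (≤⇒≯ n≤m (<ᵇ≡true⇒< eq))

<ᵇ≡false⇒≤ : ∀ {m n} → (m <ᵇ n) ≡ false → n ≤ m
<ᵇ≡false⇒≤ eq = ≮⇒≥ (λ m<n → subst T eq (<⇒<ᵇ m<n))

orderIso⇒length : ∀ xs ys → T (orderIso xs ys) → length xs ≡ length ys
orderIso⇒length [] [] _ = refl
orderIso⇒length (x ∷ xs) (y ∷ ys) h =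
  cong suc (orderIso⇒length xs ys (proj₂ (Equivalence.to T-∧ h)))

zip-at : ∀ {P : ℕ × ℕ → Set} xs ys {j} → j < length xs → length xs ≡ length ys →
         All P (zip xs ys) → P (at xs j , at ys j)
zip-at (x ∷ xs) (y ∷ ys) {zero} _ _ (p ∷ _) = p
zip-at (x ∷ xs) (y ∷ ys) {suc j} j<n eq (_ ∷ ps) = zip-at xs ys (s<s⁻¹ j<n) (suc-injective eq) ps

<ᵇ-transport : ∀ {m n k l} → (m <ᵇ n) ≡ (k <ᵇ l) → k < l → m < n
<ᵇ-transport eq k<l = <ᵇ≡true⇒< (trans eq (<⇒<ᵇ≡true k<l))

orderIso-row : ∀ {x y} xs ys → T (orderIso (x ∷ xs) (y ∷ ys)) → ∀ {j} → j < length xs →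
               (x <ᵇ at xs j) ≡ (y <ᵇ at ys j) × (at xs j <ᵇ x) ≡ (at ys j <ᵇ y)
orderIso-row xs ys iso j<n =
  let row , rest = Equivalence.to T-∧ iso
      up , down = Equivalence.to T-∧ (zip-at xs ys j<n (orderIso⇒length xs ys rest) (all⁺ _ (zip xs ys) row))
  in ==ᴮ⇒≡ up , ==ᴮ⇒≡ down

orderIso-at : ∀ xs ys → T (orderIso xs ys) → ∀ {i j} → i < length xs → j < length xs →
              at ys i < at ys j → at xs i < at xs j
orderIso-at (x ∷ xs) (y ∷ ys) iso {zero} {zero} _ _ y<y = ⊥-elim (<-irrefl refl y<y)
orderIso-at (x ∷ xs) (y ∷ ys) iso {zero} {suc j} _ j<n =
  <ᵇ-transport (proj₁ (orderIso-row xs ys iso (s<s⁻¹ j<n)))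
orderIso-at (x ∷ xs) (y ∷ ys) iso {suc i} {zero} i<n _ =
  <ᵇ-transport (proj₂ (orderIso-row xs ys iso (s<s⁻¹ i<n)))
orderIso-at (x ∷ xs) (y ∷ ys) iso {suc i} {suc j} i<n j<n =
  orderIso-at xs ys (proj₂ (Equivalence.to T-∧ iso)) (s<s⁻¹ i<n) (s<s⁻¹ j<n)

Linked-head : ∀ {x xs} → Linked _<_ (x ∷ xs) → All (x <_) xs
Linked-head [-] = []
Linked-head (x<y ∷ y∷ys) = Linked⇒All <-trans x<y y∷ys

Linked-suc⁺ : ∀ {I} → Linked _<_ I → Linked _<_ (map suc I)
Linked-suc⁺ = Linkedₚ.map⁺ ∘ Linked.map s<s

Linked-suc⁻ : ∀ {I} → Linked _<_ (map suc I) → Linked _<_ I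
Linked-suc⁻ = Linked.map s<s⁻¹ ∘ Linkedₚ.map⁻

unshift : ∀ {n} I → All (0 <_) I → All (_< suc n) I → ∃[ J ] I ≡ map suc J × All (_< n) J
unshift [] [] [] = [] , refl , []
unshift (suc i ∷ I) (_ ∷ pos) (i<n ∷ bnd) =
  let J , I≡ , J<n = unshift I pos bnd in i ∷ J , cong (suc i ∷_) I≡ , s<s⁻¹ i<n ∷ J<n

∈-choose⁻ : ∀ (f : ℕ → ℕ) n k {ys} → ys ∈ choose k (applyUpTo f n) →
            ∃[ I ] ys ≡ map f I × Linked _<_ I × All (_< n) I × length I ≡ k
∈-choose⁻ f n zero (here refl) = [] , refl , [] , [] , refl
∈-choose⁻ f (suc n) (suc k) ys∈ with ∈-++⁻ (map (f zero ∷_) (choose k (applyUpTo (f ∘ suc) n))) ys∈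
... | inj₁ ys∈₁ with ∈-map⁻ (f zero ∷_) ys∈₁
...   | ys , ys∈′ , refl with ∈-choose⁻ (f ∘ suc) n k ys∈′
...     | I , refl , inc , bnd , len =
  zero ∷ map suc I , cong (f zero ∷_) (map-∘ I) , Linked-zero I inc ,
  z<s ∷ gmap⁺ s<s bnd , cong suc (trans (length-map suc I) len)
  where
  Linked-zero : ∀ I → Linked _<_ I → Linked _<_ (zero ∷ map suc I)
  Linked-zero [] _ = [-]
  Linked-zero (_ ∷ _) inc = z<s ∷ Linked-suc⁺ inc
∈-choose⁻ f (suc n) (suc k) ys∈ | inj₂ ys∈₂ with ∈-choose⁻ (f ∘ suc) n (suc k) ys∈₂
... | I , refl , inc , bnd , len = map suc I , map-∘ I , Linked-suc⁺ inc , gmap⁺ s<s bnd , trans (length-map suc I) len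

∈-choose⁺ : ∀ (f : ℕ → ℕ) n {I} → Linked _<_ I → All (_< n) I →
            map f I ∈ choose (length I) (applyUpTo f n)
∈-choose⁺ f n {[]} _ _ = here refl
∈-choose⁺ f zero {_ ∷ _} _ (() ∷ _)
∈-choose⁺ f (suc n) {zero ∷ I} inc (_ ∷ bnd) with unshift I (Linked-head inc) bnd
... | J , refl , J<n = ∈-++⁺ˡ (∈-map⁺ (f zero ∷_) shifted)
  where
  shifted : map f (map suc J) ∈ choose (length (map suc J)) (applyUpTo (f ∘ suc) n)
  shifted = subst₂ (λ ys k → ys ∈ choose k (applyUpTo (f ∘ suc) n)) (map-∘ J) (sym (length-map suc J))
                   (∈-choose⁺ (f ∘ suc) n (Linked-suc⁻ (Linked.tail inc)) J<n)
∈-choose⁺ f (suc n) {suc i ∷ I} inc bnd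
  with unshift (suc i ∷ I) (z<s ∷ All.map (<-trans z<s) (Linked-head inc)) bnd
... | J , I≡ , J<n = ∈-++⁺ʳ _ shifted
  where
  shifted : map f (suc i ∷ I) ∈ choose (length (suc i ∷ I)) (applyUpTo (f ∘ suc) n)
  shifted = subst₂ (λ ys k → ys ∈ choose k (applyUpTo (f ∘ suc) n))
                   (trans (map-∘ J) (cong (map f) (sym I≡))) (trans (sym (length-map suc J)) (cong length (sym I≡)))
                   (∈-choose⁺ (f ∘ suc) n (Linked-suc⁻ (subst (Linked _<_) I≡ inc)) J<n)

Linked-++-∷⁻ : ∀ {n} xs → Linked _<_ (xs ++ n ∷ []) → Linked _<_ xs × All (_< n) xs
Linked-++-∷⁻ [] _ = [] , []
Linked-++-∷⁻ (x ∷ []) (x<n ∷ [-]) = [-] , x<n ∷ []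
Linked-++-∷⁻ (x ∷ y ∷ xs) (x<y ∷ chain) with Linked-++-∷⁻ (y ∷ xs) chain
... | inc , y<n ∷ bnd = x<y ∷ inc , <-trans x<y y<n ∷ y<n ∷ bnd

positions⁺ : ∀ {n} I → Linked _<_ (I ++ n ∷ []) → I ∈ choose (length I) (upTo n)
positions⁺ {n} I chain =
  let inc , bnd = Linked-++-∷⁻ I chain
  in subst (_∈ choose (length I) (upTo n)) (map-id I) (∈-choose⁺ id n inc bnd)

positions⁻ : ∀ {n k I} → I ∈ choose k (upTo n) → Linked _<_ I × All (_< n) I × length I ≡ k
positions⁻ {n} {k} I∈ with ∈-choose⁻ id n k I∈
... | J , refl , inc , bnd , len = subst (Linked _<_) (sym (map-id J)) inc ,
                                   subst (All (_< n)) (sym (map-id J)) bnd ,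
                                   trans (length-map id J) len

orderIso-at′ : ∀ xs ys → T (orderIso xs ys) → ∀ i j → {T (i <ᵇ length xs)} → {T (j <ᵇ length xs)} →
               {T (at ys i <ᵇ at ys j)} → at xs i < at xs j
orderIso-at′ xs ys iso i j {i<n} {j<n} {lt} =
  orderIso-at xs ys iso (<ᵇ⇒< i _ i<n) (<ᵇ⇒< j _ j<n) (<ᵇ⇒< _ _ lt)

Is2534 : ℕ → ℕ → ℕ → ℕ → Set
Is2534 a b c d = a < c × c < d × d < b

Is2354 : ℕ → ℕ → ℕ → ℕ → Set
Is2354 a b c d = a < b × b < d × d < c

orderIso⇒2534 : ∀ {a b c d} → T (orderIso (a ∷ b ∷ c ∷ d ∷ []) (2 ∷ 5 ∷ 3 ∷ 4 ∷ [])) → Is2534 a b c d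
orderIso⇒2534 {a} {b} {c} {d} iso =
  orderIso-at′ (a ∷ b ∷ c ∷ d ∷ []) (2 ∷ 5 ∷ 3 ∷ 4 ∷ []) iso 0 2 ,
  orderIso-at′ (a ∷ b ∷ c ∷ d ∷ []) (2 ∷ 5 ∷ 3 ∷ 4 ∷ []) iso 2 3 ,
  orderIso-at′ (a ∷ b ∷ c ∷ d ∷ []) (2 ∷ 5 ∷ 3 ∷ 4 ∷ []) iso 3 1

orderIso⇒2354 : ∀ {a b c d} → T (orderIso (a ∷ b ∷ c ∷ d ∷ []) (2 ∷ 3 ∷ 5 ∷ 4 ∷ [])) → Is2354 a b c d
orderIso⇒2354 {a} {b} {c} {d} iso =
  orderIso-at′ (a ∷ b ∷ c ∷ d ∷ []) (2 ∷ 3 ∷ 5 ∷ 4 ∷ []) iso 0 1 ,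
  orderIso-at′ (a ∷ b ∷ c ∷ d ∷ []) (2 ∷ 3 ∷ 5 ∷ 4 ∷ []) iso 1 3 ,
  orderIso-at′ (a ∷ b ∷ c ∷ d ∷ []) (2 ∷ 3 ∷ 5 ∷ 4 ∷ []) iso 3 2

orderIso⇒third<first : ∀ {a b e c d} ys → {T (at ys 2 <ᵇ at ys 0)} →
                       T (orderIso (a ∷ b ∷ e ∷ c ∷ d ∷ []) ys) → e < a
orderIso⇒third<first {a} {b} {e} {c} {d} ys {lt} iso =
  orderIso-at′ (a ∷ b ∷ e ∷ c ∷ d ∷ []) ys iso 2 0 {_} {_} {lt}

-- Unfolding orderIso leaves only <ᵇ-comparisons of entries, and the chain decides each of them.
2534⇒orderIso : ∀ {a b c d} → Is2534 a b c d → T (orderIso (a ∷ b ∷ c ∷ d ∷ []) (2 ∷ 5 ∷ 3 ∷ 4 ∷ []))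
2534⇒orderIso (a<c , c<d , d<b)
  rewrite <⇒<ᵇ≡true a<c | ≤⇒<ᵇ≡false (<⇒≤ a<c) | <⇒<ᵇ≡true c<d | ≤⇒<ᵇ≡false (<⇒≤ c<d)
        | <⇒<ᵇ≡true d<b | ≤⇒<ᵇ≡false (<⇒≤ d<b)
        | <⇒<ᵇ≡true (<-trans a<c c<d) | ≤⇒<ᵇ≡false (<⇒≤ (<-trans a<c c<d))
        | <⇒<ᵇ≡true (<-trans c<d d<b) | ≤⇒<ᵇ≡false (<⇒≤ (<-trans c<d d<b))
        | <⇒<ᵇ≡true (<-trans a<c (<-trans c<d d<b)) | ≤⇒<ᵇ≡false (<⇒≤ (<-trans a<c (<-trans c<d d<b))) = tt

25134⇒orderIso : ∀ {a b e c d} → e < a → Is2534 a b c d →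
                 T (orderIso (a ∷ b ∷ e ∷ c ∷ d ∷ []) (2 ∷ 5 ∷ 1 ∷ 3 ∷ 4 ∷ []))
25134⇒orderIso e<a (a<c , c<d , d<b)
  rewrite <⇒<ᵇ≡true a<c | ≤⇒<ᵇ≡false (<⇒≤ a<c) | <⇒<ᵇ≡true c<d | ≤⇒<ᵇ≡false (<⇒≤ c<d)
        | <⇒<ᵇ≡true d<b | ≤⇒<ᵇ≡false (<⇒≤ d<b)
        | <⇒<ᵇ≡true (<-trans a<c c<d) | ≤⇒<ᵇ≡false (<⇒≤ (<-trans a<c c<d))
        | <⇒<ᵇ≡true (<-trans c<d d<b) | ≤⇒<ᵇ≡false (<⇒≤ (<-trans c<d d<b))
        | <⇒<ᵇ≡true (<-trans a<c (<-trans c<d d<b)) | ≤⇒<ᵇ≡false (<⇒≤ (<-trans a<c (<-trans c<d d<b)))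
        | <⇒<ᵇ≡true e<a | ≤⇒<ᵇ≡false (<⇒≤ e<a)
        | <⇒<ᵇ≡true (<-trans e<a a<c) | ≤⇒<ᵇ≡false (<⇒≤ (<-trans e<a a<c))
        | <⇒<ᵇ≡true (<-trans e<a (<-trans a<c c<d)) | ≤⇒<ᵇ≡false (<⇒≤ (<-trans e<a (<-trans a<c c<d)))
        | <⇒<ᵇ≡true (<-trans e<a (<-trans a<c (<-trans c<d d<b)))
        | ≤⇒<ᵇ≡false (<⇒≤ (<-trans e<a (<-trans a<c (<-trans c<d d<b)))) = tt

2354⇒orderIso : ∀ {a b c d} → Is2354 a b c d → T (orderIso (a ∷ b ∷ c ∷ d ∷ []) (2 ∷ 3 ∷ 5 ∷ 4 ∷ []))
2354⇒orderIso (a<b , b<d , d<c)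
  rewrite <⇒<ᵇ≡true a<b | ≤⇒<ᵇ≡false (<⇒≤ a<b) | <⇒<ᵇ≡true b<d | ≤⇒<ᵇ≡false (<⇒≤ b<d)
        | <⇒<ᵇ≡true d<c | ≤⇒<ᵇ≡false (<⇒≤ d<c)
        | <⇒<ᵇ≡true (<-trans a<b b<d) | ≤⇒<ᵇ≡false (<⇒≤ (<-trans a<b b<d))
        | <⇒<ᵇ≡true (<-trans b<d d<c) | ≤⇒<ᵇ≡false (<⇒≤ (<-trans b<d d<c))
        | <⇒<ᵇ≡true (<-trans a<b (<-trans b<d d<c)) | ≤⇒<ᵇ≡false (<⇒≤ (<-trans a<b (<-trans b<d d<c))) = tt

23154⇒orderIso : ∀ {a b e c d} → e < a → Is2354 a b c d →
                 T (orderIso (a ∷ b ∷ e ∷ c ∷ d ∷ []) (2 ∷ 3 ∷ 1 ∷ 5 ∷ 4 ∷ []))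
23154⇒orderIso e<a (a<b , b<d , d<c)
  rewrite <⇒<ᵇ≡true a<b | ≤⇒<ᵇ≡false (<⇒≤ a<b) | <⇒<ᵇ≡true b<d | ≤⇒<ᵇ≡false (<⇒≤ b<d)
        | <⇒<ᵇ≡true d<c | ≤⇒<ᵇ≡false (<⇒≤ d<c)
        | <⇒<ᵇ≡true (<-trans a<b b<d) | ≤⇒<ᵇ≡false (<⇒≤ (<-trans a<b b<d))
        | <⇒<ᵇ≡true (<-trans b<d d<c) | ≤⇒<ᵇ≡false (<⇒≤ (<-trans b<d d<c))
        | <⇒<ᵇ≡true (<-trans a<b (<-trans b<d d<c)) | ≤⇒<ᵇ≡false (<⇒≤ (<-trans a<b (<-trans b<d d<c)))
        | <⇒<ᵇ≡true e<a | ≤⇒<ᵇ≡false (<⇒≤ e<a)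
        | <⇒<ᵇ≡true (<-trans e<a a<b) | ≤⇒<ᵇ≡false (<⇒≤ (<-trans e<a a<b))
        | <⇒<ᵇ≡true (<-trans e<a (<-trans a<b b<d)) | ≤⇒<ᵇ≡false (<⇒≤ (<-trans e<a (<-trans a<b b<d)))
        | <⇒<ᵇ≡true (<-trans e<a (<-trans a<b (<-trans b<d d<c)))
        | ≤⇒<ᵇ≡false (<⇒≤ (<-trans e<a (<-trans a<b (<-trans b<d d<c)))) = tt

-- Patterns with a barred third letter

BarAvoids : (ℕ → ℕ → ℕ → ℕ → Set) → List ℕ → Set
BarAvoids P π = ∀ {a b c d} → a < b → b < c → c < d → d < length π →
  P (at π a) (at π b) (at π c) (at π d) → ∃[ e ] b < e × e < c × at π e < at π a

module ThirdLetterBarred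
  (l₁ l₂ l₃ l₄ l₅ : ℕ) (P : ℕ → ℕ → ℕ → ℕ → Set)
  (orderIso⇒P : ∀ a b c d → T (orderIso (a ∷ b ∷ c ∷ d ∷ []) (l₁ ∷ l₂ ∷ l₄ ∷ l₅ ∷ [])) → P a b c d)
  (P⇒orderIso : ∀ a b c d → P a b c d → T (orderIso (a ∷ b ∷ c ∷ d ∷ []) (l₁ ∷ l₂ ∷ l₄ ∷ l₅ ∷ [])))
  (orderIso⇒bar< : ∀ a b e c d → T (orderIso (a ∷ b ∷ e ∷ c ∷ d ∷ []) (l₁ ∷ l₂ ∷ l₃ ∷ l₄ ∷ l₅ ∷ [])) → e < a)
  (bar<⇒orderIso : ∀ a b e c d → e < a → P a b c d →
                   T (orderIso (a ∷ b ∷ e ∷ c ∷ d ∷ []) (l₁ ∷ l₂ ∷ l₃ ∷ l₄ ∷ l₅ ∷ [])))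
  where

  σ : BarredPattern
  σ = barred (l₁ ∷ l₂ ∷ l₃ ∷ l₄ ∷ l₅ ∷ []) (false ∷ false ∷ true ∷ false ∷ false ∷ [])

  extendsTo : List ℕ → List ℕ → List ℕ → Bool
  extendsTo π I J = orderIso (select π J) (letters σ) ∧ (keepUnbarred (bars σ) J ==ᴸ I)

  occurrenceExtends : List ℕ → List ℕ → Bool
  occurrenceExtends π I =
    not (orderIso (select π I) (l₁ ∷ l₂ ∷ l₄ ∷ l₅ ∷ [])) ∨ any (extendsTo π I) (choose 5 (upTo (length π)))

  avoids⇒BarAvoids : ∀ π → T (avoids σ π) → BarAvoids P π
  avoids⇒BarAvoids π av {a} {b} {c} {d} a<b b<c c<d d<n occ
    with Equivalence.to T-∨
           (All.lookup (all⁺ _ _ av) (positions⁺ (a ∷ b ∷ c ∷ d ∷ []) (a<b ∷ b<c ∷ c<d ∷ d<n ∷ [-])))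
  ... | inj₁ noOcc = ⊥-elim (Equivalence.to T-not⇔¬T noOcc (P⇒orderIso (at π a) (at π b) (at π c) (at π d) occ))
  ... | inj₂ extends with find (any⁻ (extendsTo π (a ∷ b ∷ c ∷ d ∷ [])) (choose 5 (upTo (length π))) extends)
  ... | J , J∈ , extension with positions⁻ {length π} J∈
  ... | inc , _ , len = extract J inc len (Equivalence.to T-∧ extension)
    where
    extract : ∀ J → Linked _<_ J → length J ≡ 5 →
              T (orderIso (select π J) (letters σ)) × T (keepUnbarred (bars σ) J ==ᴸ (a ∷ b ∷ c ∷ d ∷ [])) →
              ∃[ e ] b < e × e < c × at π e < at π a
    extract (j₁ ∷ j₂ ∷ e ∷ j₄ ∷ j₅ ∷ []) (_ ∷ b<e ∷ e<c ∷ _) refl (iso , unbarred)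
      with ==ᴸ⇒≡ (j₁ ∷ j₂ ∷ j₄ ∷ j₅ ∷ []) (a ∷ b ∷ c ∷ d ∷ []) unbarred
    ... | refl = e , b<e , e<c , orderIso⇒bar< (at π a) (at π b) (at π e) (at π c) (at π d) iso

  BarAvoids⇒avoids : ∀ π → BarAvoids P π → T (avoids σ π)
  BarAvoids⇒avoids π bar = all⁻ (occurrenceExtends π) (All.tabulate (λ I∈ → extends _ (positions⁻ I∈)))
    where
    extends : ∀ I → Linked _<_ I × All (_< length π) I × length I ≡ 4 → T (occurrenceExtends π I)
    extends (a ∷ b ∷ c ∷ d ∷ []) (a<b ∷ b<c ∷ c<d ∷ [-] , _ ∷ _ ∷ _ ∷ d<n ∷ [] , refl)
      with T? (orderIso (select π (a ∷ b ∷ c ∷ d ∷ [])) (l₁ ∷ l₂ ∷ l₄ ∷ l₅ ∷ []))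
    ... | no ¬iso = Equivalence.from T-∨ (inj₁ (Equivalence.from T-not⇔¬T ¬iso))
    ... | yes iso with bar a<b b<c c<d d<n (orderIso⇒P (at π a) (at π b) (at π c) (at π d) iso)
    ... | e , b<e , e<c , e<a =
      Equivalence.from T-∨ (inj₂ (any⁺ (extendsTo π (a ∷ b ∷ c ∷ d ∷ [])) (lose J∈ extension)))
      where
      J∈ : (a ∷ b ∷ e ∷ c ∷ d ∷ []) ∈ choose 5 (upTo (length π))
      J∈ = positions⁺ (a ∷ b ∷ e ∷ c ∷ d ∷ []) (a<b ∷ b<e ∷ e<c ∷ c<d ∷ d<n ∷ [-])
      extension : T (extendsTo π (a ∷ b ∷ c ∷ d ∷ []) (a ∷ b ∷ e ∷ c ∷ d ∷ []))
      extension = Equivalence.from T-∧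
        (bar<⇒orderIso (at π a) (at π b) (at π e) (at π c) (at π d) e<a
                       (orderIso⇒P (at π a) (at π b) (at π c) (at π d) iso) ,
         ≡⇒==ᴸ (a ∷ b ∷ c ∷ d ∷ []))

Any⇒at : ∀ {Q : ℕ → Set} π → Any Q π → ∃[ j ] j < length π × Q (at π j)
Any⇒at (u ∷ π) (here q) = zero , z<s , q
Any⇒at (u ∷ π) (there q) = let j , j<n , qj = Any⇒at π q in suc j , s<s j<n , qj

at⇒Any : ∀ {Q : ℕ → Set} π {j} → j < length π → Q (at π j) → Any Q π
at⇒Any (u ∷ π) {zero} _ q = here q
at⇒Any (u ∷ π) {suc j} j<n q = there (at⇒Any π (s<s⁻¹ j<n) q)

module Occurrences (P : ℕ → ℕ → ℕ → ℕ → Set) where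

  -- Bad π: π has an occurrence x y z u of P with no entry below x between y and z.
  data Bad₂ (x y : ℕ) : List ℕ → Set where
    skip : ∀ {v π} → x ≤ v → Bad₂ x y π → Bad₂ x y (v ∷ π)
    pick : ∀ {z π} → Any (P x y z) π → Bad₂ x y (z ∷ π)

  data Bad₁ (x : ℕ) : List ℕ → Set where
    skip : ∀ {v π} → Bad₁ x π → Bad₁ x (v ∷ π)
    pick : ∀ {y π} → Bad₂ x y π → Bad₁ x (y ∷ π)

  data Bad : List ℕ → Set where
    skip : ∀ {v π} → Bad π → Bad (v ∷ π)
    pick : ∀ {x π} → Bad₁ x π → Bad (x ∷ π)

  Unguarded₂ : ℕ → ℕ → List ℕ → Set
  Unguarded₂ x y π = ∃[ c ] ∃[ d ] c < d × d < length π × P x y (at π c) (at π d) ×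
                     (∀ {e} → e < c → x ≤ at π e)

  Unguarded₁ : ℕ → List ℕ → Set
  Unguarded₁ x π = ∃[ b ] ∃[ c ] ∃[ d ] b < c × c < d × d < length π × P x (at π b) (at π c) (at π d) ×
                   (∀ {e} → b < e → e < c → x ≤ at π e)

  Unguarded : List ℕ → Set
  Unguarded π = ∃[ a ] ∃[ b ] ∃[ c ] ∃[ d ] a < b × b < c × c < d × d < length π ×
                P (at π a) (at π b) (at π c) (at π d) × (∀ {e} → b < e → e < c → at π a ≤ at π e)

  Bad₂⇒Unguarded₂ : ∀ {x y} π → Bad₂ x y π → Unguarded₂ x y π
  Bad₂⇒Unguarded₂ {x} (v ∷ π) (skip x≤v bad) with Bad₂⇒Unguarded₂ π bad
  ... | c , d , c<d , d<n , occ , guard = suc c , suc d , s<s c<d , s<s d<n , occ , guard′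
    where
    guard′ : ∀ {e} → e < suc c → x ≤ at (v ∷ π) e
    guard′ {zero} _ = x≤v
    guard′ {suc e} e<c = guard (s<s⁻¹ e<c)
  Bad₂⇒Unguarded₂ (z ∷ π) (pick u) with Any⇒at π u
  ... | d , d<n , occ = zero , suc d , z<s , s<s d<n , occ , λ ()

  Bad₁⇒Unguarded₁ : ∀ {x} π → Bad₁ x π → Unguarded₁ x π
  Bad₁⇒Unguarded₁ {x} (v ∷ π) (skip bad) with Bad₁⇒Unguarded₁ π bad
  ... | b , c , d , b<c , c<d , d<n , occ , guard = suc b , suc c , suc d , s<s b<c , s<s c<d , s<s d<n , occ , guard′
    where
    guard′ : ∀ {e} → suc b < e → e < suc c → x ≤ at (v ∷ π) e
    guard′ {suc e} b<e e<c = guard (s<s⁻¹ b<e) (s<s⁻¹ e<c)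
  Bad₁⇒Unguarded₁ {x} (y ∷ π) (pick bad) with Bad₂⇒Unguarded₂ π bad
  ... | c , d , c<d , d<n , occ , guard = zero , suc c , suc d , z<s , s<s c<d , s<s d<n , occ , guard′
    where
    guard′ : ∀ {e} → 0 < e → e < suc c → x ≤ at (y ∷ π) e
    guard′ {suc e} _ e<c = guard (s<s⁻¹ e<c)

  Bad⇒Unguarded : ∀ π → Bad π → Unguarded π
  Bad⇒Unguarded (v ∷ π) (skip bad) with Bad⇒Unguarded π bad
  ... | a , b , c , d , a<b , b<c , c<d , d<n , occ , guard =
    suc a , suc b , suc c , suc d , s<s a<b , s<s b<c , s<s c<d , s<s d<n , occ , guard′
    where
    guard′ : ∀ {e} → suc b < e → e < suc c → at π a ≤ at (v ∷ π) e
    guard′ {suc e} b<e e<c = guard (s<s⁻¹ b<e) (s<s⁻¹ e<c)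
  Bad⇒Unguarded (x ∷ π) (pick bad) with Bad₁⇒Unguarded₁ π bad
  ... | b , c , d , b<c , c<d , d<n , occ , guard =
    zero , suc b , suc c , suc d , z<s , s<s b<c , s<s c<d , s<s d<n , occ , guard′
    where
    guard′ : ∀ {e} → suc b < e → e < suc c → x ≤ at (x ∷ π) e
    guard′ {suc e} b<e e<c = guard (s<s⁻¹ b<e) (s<s⁻¹ e<c)

  Bad⇒¬BarAvoids : ∀ π → Bad π → ¬ BarAvoids P π
  Bad⇒¬BarAvoids π bad bar with Bad⇒Unguarded π bad
  ... | a , b , c , d , a<b , b<c , c<d , d<n , occ , guard with bar a<b b<c c<d d<n occ
  ... | e , b<e , e<c , πe<πa = <⇒≱ πe<πa (guard b<e e<c)

  Bad₂-or-guarded : ∀ {x y} π {c d} → c < d → d < length π → P x y (at π c) (at π d) →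
                    Bad₂ x y π ⊎ ∃[ e ] e < c × at π e < x
  Bad₂-or-guarded (z ∷ π) {zero} {suc d} _ d<n occ = inj₁ (pick (at⇒Any π (s<s⁻¹ d<n) occ))
  Bad₂-or-guarded {x} (v ∷ π) {suc c} {suc d} c<d d<n occ with x ≤? v
  ... | no x≰v = inj₂ (zero , z<s , ≰⇒> x≰v)
  ... | yes x≤v with Bad₂-or-guarded π (s<s⁻¹ c<d) (s<s⁻¹ d<n) occ
  ...   | inj₁ bad = inj₁ (skip x≤v bad)
  ...   | inj₂ (e , e<c , πe<x) = inj₂ (suc e , s<s e<c , πe<x)

  Bad₁-or-guarded : ∀ {x} π {b c d} → b < c → c < d → d < length π → P x (at π b) (at π c) (at π d) →
                    Bad₁ x π ⊎ ∃[ e ] b < e × e < c × at π e < x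
  Bad₁-or-guarded (y ∷ π) {zero} {suc c} {suc d} _ c<d d<n occ
    with Bad₂-or-guarded π (s<s⁻¹ c<d) (s<s⁻¹ d<n) occ
  ... | inj₁ bad = inj₁ (pick bad)
  ... | inj₂ (e , e<c , πe<x) = inj₂ (suc e , z<s , s<s e<c , πe<x)
  Bad₁-or-guarded (v ∷ π) {suc b} {suc c} {suc d} b<c c<d d<n occ
    with Bad₁-or-guarded π (s<s⁻¹ b<c) (s<s⁻¹ c<d) (s<s⁻¹ d<n) occ
  ... | inj₁ bad = inj₁ (skip bad)
  ... | inj₂ (e , b<e , e<c , πe<x) = inj₂ (suc e , s<s b<e , s<s e<c , πe<x)

  Bad-or-guarded : ∀ π {a b c d} → a < b → b < c → c < d → d < length π →
                   P (at π a) (at π b) (at π c) (at π d) →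
                   Bad π ⊎ ∃[ e ] b < e × e < c × at π e < at π a
  Bad-or-guarded (x ∷ π) {zero} {suc b} {suc c} {suc d} _ b<c c<d d<n occ
    with Bad₁-or-guarded π (s<s⁻¹ b<c) (s<s⁻¹ c<d) (s<s⁻¹ d<n) occ
  ... | inj₁ bad = inj₁ (pick bad)
  ... | inj₂ (e , b<e , e<c , πe<x) = inj₂ (suc e , s<s b<e , s<s e<c , πe<x)
  Bad-or-guarded (v ∷ π) {suc a} {suc b} {suc c} {suc d} a<b b<c c<d d<n occ
    with Bad-or-guarded π (s<s⁻¹ a<b) (s<s⁻¹ b<c) (s<s⁻¹ c<d) (s<s⁻¹ d<n) occ
  ... | inj₁ bad = inj₁ (skip bad)
  ... | inj₂ (e , b<e , e<c , πe<πa) = inj₂ (suc e , s<s b<e , s<s e<c , πe<πa)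

  ¬Bad⇒BarAvoids : ∀ π → ¬ Bad π → BarAvoids P π
  ¬Bad⇒BarAvoids π ¬bad a<b b<c c<d d<n occ with Bad-or-guarded π a<b b<c c<d d<n occ
  ... | inj₁ bad = ⊥-elim (¬bad bad)
  ... | inj₂ guarded = guarded

-- Blocks of left-to-right minima

Block : Set
Block = ℕ × List ℕ

flatten : List Block → List ℕ
flatten [] = []
flatten ((m , w) ∷ bs) = m ∷ w ++ flatten bs

HeadBelow : ℕ → List Block → Set
HeadBelow m [] = ⊤
HeadBelow m ((m′ , _) ∷ _) = m′ < m

LRMinBlocks : List Block → Set
LRMinBlocks [] = ⊤
LRMinBlocks ((m , w) ∷ bs) = All (m <_) w × HeadBelow m bs × LRMinBlocks bs

EveryBlock : (ℕ → List ℕ → List ℕ → Set) → List Block → Set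
EveryBlock Q [] = ⊤
EveryBlock Q ((m , w) ∷ bs) = Q m w (flatten bs) × EveryBlock Q bs

absorb : ℕ → List Block → List ℕ × List Block
absorb x [] = [] , []
absorb x ((m , w) ∷ bs) with x <ᵇ m
... | true = (m ∷ w ++ proj₁ (absorb x bs)) , proj₂ (absorb x bs)
... | false = [] , (m , w) ∷ bs

blocks : List ℕ → List Block
blocks [] = []
blocks (x ∷ π) = (x , proj₁ (absorb x (blocks π))) ∷ proj₂ (absorb x (blocks π))

flatten-absorb : ∀ x bs → proj₁ (absorb x bs) ++ flatten (proj₂ (absorb x bs)) ≡ flatten bs
flatten-absorb x [] = refl
flatten-absorb x ((m , w) ∷ bs) with x <ᵇ m
... | true = cong (m ∷_) (trans (++-assoc w _ _) (cong (w ++_) (flatten-absorb x bs)))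
... | false = refl

flatten-blocks : ∀ π → flatten (blocks π) ≡ π
flatten-blocks [] = refl
flatten-blocks (x ∷ π) = cong (x ∷_) (trans (flatten-absorb x (blocks π)) (flatten-blocks π))

HeadAtMost : ℕ → List Block → Set
HeadAtMost x [] = ⊤
HeadAtMost x ((m , _) ∷ _) = m ≤ x

absorb-LRMin : ∀ x bs → LRMinBlocks bs →
               All (x <_) (proj₁ (absorb x bs)) × HeadAtMost x (proj₂ (absorb x bs)) × LRMinBlocks (proj₂ (absorb x bs))
absorb-LRMin x [] _ = [] , tt , tt
absorb-LRMin x ((m , w) ∷ bs) (m<w , hb , lr) with x <ᵇ m in eq
... | true = let x<rest , hd , lr′ = absorb-LRMin x bs lr
                 x<m = <ᵇ≡true⇒< eq
             in x<m ∷ ++⁺ (All.map (<-trans x<m) m<w) x<rest , hd , lr′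
... | false = [] , <ᵇ≡false⇒≤ eq , m<w , hb , lr

HeadAtMost⇒HeadBelow : ∀ x bs → HeadAtMost x bs → x ∉ flatten bs → HeadBelow x bs
HeadAtMost⇒HeadBelow x [] _ _ = tt
HeadAtMost⇒HeadBelow x ((m , w) ∷ bs) m≤x x∉ with m≤n⇒m<n∨m≡n m≤x
... | inj₁ m<x = m<x
... | inj₂ refl = ⊥-elim (x∉ (here refl))

blocks-LRMin : ∀ π → Unique π → LRMinBlocks (blocks π)
blocks-LRMin [] _ = tt
blocks-LRMin (x ∷ π) (x∉π ∷ uπ) =
  let x<w , hd , lr = absorb-LRMin x (blocks π) (blocks-LRMin π uπ)
  in x<w , HeadAtMost⇒HeadBelow x _ hd x∉rest , lr
  where
  x∉rest : x ∉ flatten (proj₂ (absorb x (blocks π)))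
  x∉rest x∈ = All.lookup x∉π (subst (x ∈_) (trans (flatten-absorb x (blocks π)) (flatten-blocks π)) (∈-++⁺ʳ _ x∈)) refl

absorb-++ : ∀ v cs bs → HeadAtMost v bs →
            absorb v (cs ++ bs) ≡ (proj₁ (absorb v cs) , proj₂ (absorb v cs) ++ bs)
absorb-++ v [] [] _ = refl
absorb-++ v [] ((m , w) ∷ bs) m≤v rewrite ≤⇒<ᵇ≡false m≤v = refl
absorb-++ v ((c , u) ∷ cs) bs hd with v <ᵇ c
... | true rewrite absorb-++ v cs bs hd = refl
... | false = refl

absorb-all : ∀ m cs → All (m <_) (flatten cs) → absorb m cs ≡ (flatten cs , [])
absorb-all m [] _ = refl
absorb-all m ((c , u) ∷ cs) (m<c ∷ m<rest)
  rewrite <⇒<ᵇ≡true m<c | absorb-all m cs (++⁻ʳ u m<rest) = refl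

HeadBelow⇒HeadAtMost : ∀ {k v} bs → HeadBelow k bs → k ≤ v → HeadAtMost v bs
HeadBelow⇒HeadAtMost [] _ _ = tt
HeadBelow⇒HeadAtMost (_ ∷ _) m<k k≤v = <⇒≤ (<-≤-trans m<k k≤v)

blocks-++ : ∀ {m} w ρ → HeadBelow m (blocks ρ) → All (m <_) w →
            ∃[ cs ] blocks (w ++ ρ) ≡ cs ++ blocks ρ × flatten cs ≡ w
blocks-++ [] ρ _ _ = [] , refl , refl
blocks-++ (v ∷ w) ρ hb (m<v ∷ m<w) with blocks-++ w ρ hb m<w
... | cs , eq , flat = (v , proj₁ (absorb v cs)) ∷ proj₂ (absorb v cs) , eq′ , flat′
  where
  eq′ : blocks (v ∷ w ++ ρ) ≡ ((v , proj₁ (absorb v cs)) ∷ proj₂ (absorb v cs)) ++ blocks ρ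
  eq′ rewrite eq | absorb-++ v cs (blocks ρ) (HeadBelow⇒HeadAtMost (blocks ρ) hb (<⇒≤ m<v)) = refl
  flat′ : v ∷ proj₁ (absorb v cs) ++ flatten (proj₂ (absorb v cs)) ≡ v ∷ w
  flat′ = cong (v ∷_) (trans (flatten-absorb v cs) flat)

blocks-flatten : ∀ bs → LRMinBlocks bs → blocks (flatten bs) ≡ bs
blocks-flatten [] _ = refl
blocks-flatten ((m , w) ∷ bs) (m<w , hb , lr) with blocks-flatten bs lr
... | eq with blocks-++ w (flatten bs) (subst (HeadBelow m) (sym eq) hb) m<w
... | cs , eq′ , flat
  rewrite eq′ | eq | absorb-++ m cs bs (HeadBelow⇒HeadAtMost bs hb ≤-refl)
        | absorb-all m cs (subst (All (m <_)) (sym flat) m<w) | flat = refl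

module BlockCriterion (P : ℕ → ℕ → ℕ → ℕ → Set)
  (first<second : ∀ {x y z u} → P x y z u → x < y)
  (first<third : ∀ {x y z u} → P x y z u → x < z)
  (lower-first : ∀ {x′ x y z u} → x′ ≤ x → P x y z u → P x′ y z u)
  where

  open Occurrences P public

  -- BlockBad m w ρ: a Bad occurrence in m w ρ starting at m whose second and third letters lie in w.
  data BlockBad₂ (m y : ℕ) : List ℕ → List ℕ → Set where
    skip : ∀ {v w ρ} → BlockBad₂ m y w ρ → BlockBad₂ m y (v ∷ w) ρ
    pick : ∀ {z w ρ} → Any (P m y z) (w ++ ρ) → BlockBad₂ m y (z ∷ w) ρ

  data BlockBad (m : ℕ) : List ℕ → List ℕ → Set where
    skip : ∀ {v w ρ} → BlockBad m w ρ → BlockBad m (v ∷ w) ρ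
    pick : ∀ {y w ρ} → BlockBad₂ m y w ρ → BlockBad m (y ∷ w) ρ

  GoodBlocks : List Block → Set
  GoodBlocks = EveryBlock (λ m w ρ → ¬ BlockBad m w ρ)

  BlockBad₂⇒Bad₂ : ∀ {m y w ρ} → All (m <_) w → BlockBad₂ m y w ρ → Bad₂ m y (w ++ ρ)
  BlockBad₂⇒Bad₂ (m<v ∷ m<w) (skip bad) = skip (<⇒≤ m<v) (BlockBad₂⇒Bad₂ m<w bad)
  BlockBad₂⇒Bad₂ (_ ∷ _) (pick occ) = pick occ

  BlockBad⇒Bad₁ : ∀ {m w ρ} → All (m <_) w → BlockBad m w ρ → Bad₁ m (w ++ ρ)
  BlockBad⇒Bad₁ (_ ∷ m<w) (skip bad) = skip (BlockBad⇒Bad₁ m<w bad)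
  BlockBad⇒Bad₁ (_ ∷ m<w) (pick bad) = pick (BlockBad₂⇒Bad₂ m<w bad)

  Bad-++⁺ʳ : ∀ w {ρ} → Bad ρ → Bad (w ++ ρ)
  Bad-++⁺ʳ [] bad = bad
  Bad-++⁺ʳ (v ∷ w) bad = skip (Bad-++⁺ʳ w bad)

  ¬Bad⇒GoodBlocks : ∀ bs → LRMinBlocks bs → ¬ Bad (flatten bs) → GoodBlocks bs
  ¬Bad⇒GoodBlocks [] _ _ = tt
  ¬Bad⇒GoodBlocks ((m , w) ∷ bs) (m<w , _ , lr) ¬bad =
    (λ bad → ¬bad (pick (BlockBad⇒Bad₁ m<w bad))) ,
    ¬Bad⇒GoodBlocks bs lr (λ bad → ¬bad (skip (Bad-++⁺ʳ w bad)))

  Bad₂-lower : ∀ {x′ x y π} → x′ ≤ x → Bad₂ x y π → Bad₂ x′ y π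
  Bad₂-lower x′≤x (skip x≤v bad) = skip (≤-trans x′≤x x≤v) (Bad₂-lower x′≤x bad)
  Bad₂-lower x′≤x (pick occ) = pick (Any.map (lower-first x′≤x) occ)

  Bad₁-lower : ∀ {x′ x π} → x′ ≤ x → Bad₁ x π → Bad₁ x′ π
  Bad₁-lower x′≤x (skip bad) = skip (Bad₁-lower x′≤x bad)
  Bad₁-lower x′≤x (pick bad) = pick (Bad₂-lower x′≤x bad)

  Bad₂⇒< : ∀ {x y π} → Bad₂ x y π → x < y
  Bad₂⇒< (skip _ bad) = Bad₂⇒< bad
  Bad₂⇒< (pick occ) = first<second (proj₂ (Any.satisfied occ))

  Bad-split : ∀ {m} w {ρ} → All (m ≤_) w → Bad (w ++ ρ) → Bad₁ m (w ++ ρ) ⊎ Bad ρ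
  Bad-split [] _ bad = inj₂ bad
  Bad-split (v ∷ w) (_ ∷ m≤w) (skip bad) with Bad-split w m≤w bad
  ... | inj₁ bad₁ = inj₁ (skip bad₁)
  ... | inj₂ bad′ = inj₂ bad′
  Bad-split (v ∷ w) (m≤v ∷ _) (pick bad) = inj₁ (skip (Bad₁-lower m≤v bad))

  Bad₂-split : ∀ {m y} w {ρ} → Bad₂ m y (w ++ ρ) → BlockBad₂ m y w ρ ⊎ Bad₂ m y ρ
  Bad₂-split [] bad = inj₂ bad
  Bad₂-split (v ∷ w) (skip _ bad) with Bad₂-split w bad
  ... | inj₁ blockBad = inj₁ (skip blockBad)
  ... | inj₂ bad′ = inj₂ bad′
  Bad₂-split (v ∷ w) (pick occ) = inj₁ (pick occ)

  HeadBelow⇒¬Bad₂ : ∀ {m y} bs → HeadBelow m bs → ¬ Bad₂ m y (flatten bs)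
  HeadBelow⇒¬Bad₂ ((m′ , _) ∷ _) m′<m (skip m≤m′ _) = <⇒≱ m′<m m≤m′
  HeadBelow⇒¬Bad₂ ((m′ , _) ∷ _) m′<m (pick occ) = <⇒≯ m′<m (first<third (proj₂ (Any.satisfied occ)))

  Bad₁-split : ∀ {m} w bs → HeadBelow m bs → Bad₁ m (w ++ flatten bs) →
               BlockBad m w (flatten bs) ⊎ Bad₁ m (flatten bs)
  Bad₁-split [] bs _ bad = inj₂ bad
  Bad₁-split (v ∷ w) bs hb (skip bad) with Bad₁-split w bs hb bad
  ... | inj₁ blockBad = inj₁ (skip blockBad)
  ... | inj₂ bad′ = inj₂ bad′
  Bad₁-split (v ∷ w) bs hb (pick bad) with Bad₂-split w bad
  ... | inj₁ blockBad = inj₁ (pick blockBad)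
  ... | inj₂ bad′ = ⊥-elim (HeadBelow⇒¬Bad₂ bs hb bad′)

  Bad₁⇒Bad : ∀ {m} bs → HeadBelow m bs → Bad₁ m (flatten bs) → Bad (flatten bs)
  Bad₁⇒Bad ((m′ , _) ∷ _) m′<m (skip bad) = pick (Bad₁-lower (<⇒≤ m′<m) bad)
  Bad₁⇒Bad ((m′ , _) ∷ _) m′<m (pick bad) = ⊥-elim (<⇒≯ m′<m (Bad₂⇒< bad))

  Bad-∷-split : ∀ {m} w {ρ} → All (m ≤_) w → Bad (m ∷ w ++ ρ) → Bad₁ m (w ++ ρ) ⊎ Bad ρ
  Bad-∷-split w m≤w (skip bad) = Bad-split w m≤w bad
  Bad-∷-split w m≤w (pick bad) = inj₁ bad

  GoodBlocks⇒¬Bad : ∀ bs → LRMinBlocks bs → GoodBlocks bs → ¬ Bad (flatten bs)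
  GoodBlocks⇒¬Bad ((m , w) ∷ bs) (m<w , hb , lr) (good , goods) bad
    with Bad-∷-split w (All.map <⇒≤ m<w) bad
  ... | inj₂ bad′ = GoodBlocks⇒¬Bad bs lr goods bad′
  ... | inj₁ bad₁ with Bad₁-split w bs hb bad₁
  ...   | inj₁ blockBad = good blockBad
  ...   | inj₂ bad₁′ = GoodBlocks⇒¬Bad bs lr goods (Bad₁⇒Bad bs hb bad₁′)

-- Ranks and complements

rank : List ℕ → ℕ → ℕ
rank [] x = 0
rank (u ∷ L) x with u <? x
... | yes _ = suc (rank L x)
... | no _ = rank L x

rank≡length-filter : ∀ L x → rank L x ≡ length (filter (_<? x) L)
rank≡length-filter [] x = refl
rank≡length-filter (u ∷ L) x with u <? x
... | yes u<x = trans (cong suc (rank≡length-filter L x)) (sym (cong length (filter-accept (_<? x) u<x)))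
... | no u≮x = trans (rank≡length-filter L x) (sym (cong length (filter-reject (_<? x) u≮x)))

rank-mono : ∀ L {x y} → x ≤ y → rank L x ≤ rank L y
rank-mono [] _ = z≤n
rank-mono (u ∷ L) {x} {y} x≤y with u <? x | u <? y
... | yes _ | yes _ = s≤s (rank-mono L x≤y)
... | yes u<x | no u≮y = ⊥-elim (u≮y (<-≤-trans u<x x≤y))
... | no _ | yes _ = m≤n⇒m≤1+n (rank-mono L x≤y)
... | no _ | no _ = rank-mono L x≤y

rank-strict : ∀ L {u x y} → u ∈ L → x ≤ u → u < y → rank L x < rank L y
rank-strict (v ∷ L) {u} {x} {y} (here refl) x≤u u<y with v <? x | v <? y
... | yes v<x | _ = ⊥-elim (<⇒≱ v<x x≤u)
... | no _ | yes _ = s≤s (rank-mono L (≤-trans x≤u (<⇒≤ u<y)))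
... | no _ | no v≮y = ⊥-elim (v≮y u<y)
rank-strict (v ∷ L) {u} {x} {y} (there u∈) x≤u u<y with v <? x | v <? y | rank-strict L u∈ x≤u u<y
... | yes _ | yes _ | r = s≤s r
... | yes v<x | no v≮y | _ = ⊥-elim (v≮y (<-trans v<x (≤-<-trans x≤u u<y)))
... | no _ | yes _ | r = m≤n⇒m≤1+n r
... | no _ | no _ | r = r

rank-gap : ∀ L {x y} → rank L x < rank L y → ∃[ u ] u ∈ L × x ≤ u × u < y
rank-gap (v ∷ L) {x} {y} lt with v <? x | v <? y
... | yes _ | yes _ = let u , u∈ , x≤u , u<y = rank-gap L (s<s⁻¹ lt) in u , there u∈ , x≤u , u<y
... | yes _ | no _ = let u , u∈ , x≤u , u<y = rank-gap L (<-trans (n<1+n _) lt) in u , there u∈ , x≤u , u<y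
... | no v≮x | yes v<y = v , here refl , ≮⇒≥ v≮x , v<y
... | no _ | no _ = let u , u∈ , x≤u , u<y = rank-gap L lt in u , there u∈ , x≤u , u<y

rank≤length : ∀ L x → rank L x ≤ length L
rank≤length L x = subst (_≤ length L) (sym (rank≡length-filter L x)) (length-filter (_<? x) L)

rank<length : ∀ L {x} → x ∈ L → rank L x < length L
rank<length (v ∷ L) (here refl) with v <? v
... | yes v<v = ⊥-elim (<-irrefl refl v<v)
... | no _ = s≤s (rank≤length L v)
rank<length (v ∷ L) {x} (there x∈) with v <? x
... | yes _ = s≤s (rank<length L x∈)
... | no _ = m≤n⇒m≤1+n (rank<length L x∈)

rank-↭ : ∀ {L L′} x → L ↭ L′ → rank L x ≡ rank L′ x
rank-↭ {L} {L′} x L↭L′ =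
  trans (rank≡length-filter L x) (trans (↭-length (filter-↭ (_<? x) L↭L′)) (sym (rank≡length-filter L′ x)))

rank-∷-self : ∀ x L → rank (x ∷ L) x ≡ rank L x
rank-∷-self x L with x <? x
... | yes x<x = ⊥-elim (<-irrefl refl x<x)
... | no _ = refl

rank-surjective : ∀ L → Unique L → ∀ {r} → r < length L → ∃[ y ] y ∈ L × rank L y ≡ r
rank-surjective (x ∷ L) (x∉L ∷ uL) {r} r<n with <-cmp r (rank L x)
... | tri≈ _ refl _ = x , here refl , rank-∷-self x L
... | tri< r<rx _ _ with rank-surjective L uL (<-≤-trans r<rx (rank≤length L x))
...   | y , y∈ , ry≡r = y , there y∈ , ry′
  where
  ry′ : rank (x ∷ L) y ≡ r
  ry′ with x <? y
  ... | yes x<y = ⊥-elim (<⇒≱ r<rx (subst (rank L x ≤_) ry≡r (rank-mono L (<⇒≤ x<y))))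
  ... | no _ = ry≡r
rank-surjective (x ∷ L) (x∉L ∷ uL) {suc r} r<n | tri> _ _ rx<r with rank-surjective L uL (s<s⁻¹ r<n)
...   | y , y∈ , ry≡r = y , there y∈ , ry′
  where
  ry′ : rank (x ∷ L) y ≡ suc r
  ry′ with x <? y
  ... | yes _ = cong suc ry≡r
  ... | no x≮y with m≤n⇒m<n∨m≡n (≮⇒≥ x≮y)
  ...   | inj₂ refl = ⊥-elim (All.lookup x∉L y∈ refl)
  ...   | inj₁ y<x = ⊥-elim (<⇒≱ (rank-strict L y∈ ≤-refl y<x) (subst (rank L x ≤_) (sym ry≡r) (s≤s⁻¹ rx<r)))

rank-injective : ∀ L {a b} → a ∈ L → b ∈ L → rank L a ≡ rank L b → a ≡ b
rank-injective L a∈ b∈ eq with <-cmp _ _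
... | tri< a<b _ _ = ⊥-elim (<-irrefl eq (rank-strict L a∈ ≤-refl a<b))
... | tri≈ _ a≡b _ = a≡b
... | tri> _ _ b<a = ⊥-elim (<-irrefl (sym eq) (rank-strict L b∈ ≤-refl b<a))

-- 0 when no entry of the second list has rank r.
findRank : List ℕ → List ℕ → ℕ → ℕ
findRank L [] r = 0
findRank L (y ∷ t) r with rank L y ≟ r
... | yes _ = y
... | no _ = findRank L t r

findRank-spec : ∀ L t r {y} → y ∈ t → rank L y ≡ r → findRank L t r ∈ t × rank L (findRank L t r) ≡ r
findRank-spec L (v ∷ t) r y∈ ry≡r with rank L v ≟ r
... | yes rv≡r = here refl , rv≡r
findRank-spec L (v ∷ t) r (here refl) ry≡r | no rv≢r = ⊥-elim (rv≢r ry≡r)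
findRank-spec L (v ∷ t) r (there y∈) ry≡r | no _ =
  let found∈ , rank≡ = findRank-spec L t r y∈ ry≡r in there found∈ , rank≡

mirror : List ℕ → ℕ → ℕ
mirror P x = findRank P P (length P ∸ suc (rank P x))

mirror-spec : ∀ P → Unique P → ∀ {x} → x ∈ P →
              mirror P x ∈ P × rank P (mirror P x) ≡ length P ∸ suc (rank P x)
mirror-spec P uP x∈ =
  let y , y∈ , ry≡ = rank-surjective P uP (∸-monoʳ-< z<s (rank<length P x∈)) in findRank-spec P P _ y∈ ry≡

mirror-∈ : ∀ P → Unique P → ∀ {x} → x ∈ P → mirror P x ∈ P
mirror-∈ P uP x∈ = proj₁ (mirror-spec P uP x∈)

mirror-antitone : ∀ P → Unique P → ∀ {x y} → x ∈ P → y ∈ P → x < y → mirror P y < mirror P x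
mirror-antitone P uP {x} {y} x∈ y∈ x<y with mirror-spec P uP x∈ | mirror-spec P uP y∈
... | _ , rx | _ , ry = ≰⇒> λ mx≤my → <⇒≱ rank< (rank-mono P mx≤my)
  where
  rank< : rank P (mirror P y) < rank P (mirror P x)
  rank< rewrite rx | ry = ∸-monoʳ-< (s<s (rank-strict P x∈ ≤-refl x<y)) (rank<length P y∈)

mirror⁻¹ : ∀ P → Unique P → ∀ {x y} → x ∈ P → y ∈ P → mirror P x < mirror P y → y < x
mirror⁻¹ P uP {x} {y} x∈ y∈ mx<my with <-cmp x y
... | tri< x<y _ _ = ⊥-elim (<-asym mx<my (mirror-antitone P uP x∈ y∈ x<y))
... | tri≈ _ refl _ = ⊥-elim (<-irrefl refl mx<my)
... | tri> _ _ y<x = y<x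

mirror-involutive : ∀ P → Unique P → ∀ {x} → x ∈ P → mirror P (mirror P x) ≡ x
mirror-involutive P uP {x} x∈ with mirror-spec P uP x∈
... | mx∈ , rmx with mirror-spec P uP mx∈
... | mmx∈ , rmmx = rank-injective P mmx∈ x∈ (begin
  rank P (mirror P (mirror P x))       ≡⟨ rmmx ⟩
  length P ∸ suc (rank P (mirror P x)) ≡⟨ cong (λ r → length P ∸ suc r) rmx ⟩
  length P ∸ suc (length P ∸ suc (rank P x)) ≡⟨ ∸-suc-involutive (rank<length P x∈) ⟩
  rank P x                             ∎)
  where
  open ≡-Reasoning
  ∸-suc-involutive : ∀ {r n} → r < n → n ∸ suc (n ∸ suc r) ≡ r
  ∸-suc-involutive {r} {suc n} r<n = m∸[m∸n]≡n (s≤s⁻¹ r<n)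

complement : List ℕ → List ℕ
complement P = map (mirror P) P

complement-∈ : ∀ P → Unique P → ∀ {z} → z ∈ complement P → z ∈ P
complement-∈ P uP z∈ with ∈-map⁻ (mirror P) z∈
... | x , x∈ , refl = mirror-∈ P uP x∈

Unique-map-local : ∀ {A : Set} (f : A → A) xs → Unique xs → (∀ {x y} → x ∈ xs → y ∈ xs → f x ≡ f y → x ≡ y) →
                   Unique (map f xs)
Unique-map-local f [] [] _ = []
Unique-map-local f (x ∷ xs) (x∉ ∷ u) inj =
  All.tabulate fx∉ ∷ Unique-map-local f xs u (λ x∈ y∈ → inj (there x∈) (there y∈))
  where
  fx∉ : ∀ {z} → z ∈ map f xs → f x ≢ z
  fx∉ z∈ fx≡z with ∈-map⁻ f z∈
  ... | y , y∈ , refl = All.lookup x∉ y∈ (inj (here refl) (there y∈) fx≡z)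

complement-↭ : ∀ P → Unique P → complement P ↭ P
complement-↭ P uP = ∼bag⇒↭ (unique∧set⇒bag unique uP (mk⇔ (complement-∈ P uP) from))
  where
  unique : Unique (complement P)
  unique = Unique-map-local (mirror P) P uP λ x∈ y∈ mx≡my →
    trans (sym (mirror-involutive P uP x∈)) (trans (cong (mirror P) mx≡my) (mirror-involutive P uP y∈))
  from : ∀ {z} → z ∈ P → z ∈ complement P
  from z∈ = subst (_∈ complement P) (mirror-involutive P uP z∈) (∈-map⁺ (mirror P) (mirror-∈ P uP z∈))

Unique-resp-↭ : ∀ {xs ys : List ℕ} → xs ↭ ys → Unique xs → Unique ys
Unique-resp-↭ xs↭ys = Permₛ.Unique-resp-↭ (↭⇒↭ₛ xs↭ys)

mirror-resp-↭ : ∀ P Q → P ↭ Q → Unique P → ∀ {x} → x ∈ P → mirror Q x ≡ mirror P x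
mirror-resp-↭ P Q P↭Q uP {x} x∈ with mirror-spec Q (Unique-resp-↭ P↭Q uP) (∈-resp-↭ P↭Q x∈) | mirror-spec P uP x∈
... | mQ∈ , rQ | mP∈ , rP = rank-injective P (∈-resp-↭ (↭-sym P↭Q) mQ∈) mP∈ (begin
  rank P (mirror Q x)               ≡⟨ rank-↭ _ P↭Q ⟩
  rank Q (mirror Q x)               ≡⟨ rQ ⟩
  length Q ∸ suc (rank Q x)         ≡⟨ cong₂ (λ n r → n ∸ suc r) (sym (↭-length P↭Q)) (sym (rank-↭ x P↭Q)) ⟩
  length P ∸ suc (rank P x)         ≡⟨ sym rP ⟩
  rank P (mirror P x)               ∎)
  where open ≡-Reasoning

complement-involutive : ∀ P → Unique P → complement (complement P) ≡ P
complement-involutive P uP = trans (sym (map-∘ P)) (map-id-local (All.tabulate λ x∈ →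
  trans (mirror-resp-↭ P (complement P) (↭-sym (complement-↭ P uP)) uP (mirror-∈ P uP x∈))
        (mirror-involutive P uP x∈)))

data Contains₃After (R : ℕ → ℕ → ℕ → Set) (y : ℕ) : List ℕ → Set where
  skip : ∀ {v w} → Contains₃After R y w → Contains₃After R y (v ∷ w)
  pick : ∀ {z w} → Any (R y z) w → Contains₃After R y (z ∷ w)

data Contains₃ (R : ℕ → ℕ → ℕ → Set) : List ℕ → Set where
  skip : ∀ {v w} → Contains₃ R w → Contains₃ R (v ∷ w)
  pick : ∀ {y w} → Contains₃After R y w → Contains₃ R (y ∷ w)

Contains₃After-map⁻ : ∀ {R} (f : ℕ → ℕ) {y} w → Contains₃After R (f y) (map f w) →
                      Contains₃After (λ a b c → R (f a) (f b) (f c)) y w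
Contains₃After-map⁻ f (v ∷ w) (skip c) = skip (Contains₃After-map⁻ f w c)
Contains₃After-map⁻ f (z ∷ w) (pick occ) = pick (Anyₚ.map⁻ occ)

Contains₃-map⁻ : ∀ {R} (f : ℕ → ℕ) w → Contains₃ R (map f w) → Contains₃ (λ a b c → R (f a) (f b) (f c)) w
Contains₃-map⁻ f (v ∷ w) (skip c) = skip (Contains₃-map⁻ f w c)
Contains₃-map⁻ f (y ∷ w) (pick c) = pick (Contains₃After-map⁻ f w c)

Contains₃After-mono : ∀ {R R′ : ℕ → ℕ → ℕ → Set} {S : ℕ → Set} {y w} → S y → All S w →
                      (∀ {a b c} → S a → S b → S c → R a b c → R′ a b c) →
                      Contains₃After R y w → Contains₃After R′ y w
Contains₃After-mono sy (_ ∷ sw) f (skip c) = skip (Contains₃After-mono sy sw f c)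
Contains₃After-mono sy (sz ∷ sw) f (pick occ) =
  let c , c∈ , r = find occ in pick (lose c∈ (f sy sz (All.lookup sw c∈) r))

Contains₃-mono : ∀ {R R′ : ℕ → ℕ → ℕ → Set} {S : ℕ → Set} {w} → All S w →
                 (∀ {a b c} → S a → S b → S c → R a b c → R′ a b c) →
                 Contains₃ R w → Contains₃ R′ w
Contains₃-mono (_ ∷ sw) f (skip c) = skip (Contains₃-mono sw f c)
Contains₃-mono (sy ∷ sw) f (pick c) = pick (Contains₃After-mono sy sw f c)

Contains₃After-resp-⊆ : ∀ {R y xs ys} → xs ⊆ ys → Contains₃After R y xs → Contains₃After R y ys
Contains₃After-resp-⊆ (v ∷ʳ xs⊆ys) c = skip (Contains₃After-resp-⊆ xs⊆ys c)
Contains₃After-resp-⊆ (refl ∷ xs⊆ys) (skip c) = skip (Contains₃After-resp-⊆ xs⊆ys c)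
Contains₃After-resp-⊆ (refl ∷ xs⊆ys) (pick occ) = pick (Any-resp-⊆ xs⊆ys occ)

Contains₃-resp-⊆ : ∀ {R xs ys} → xs ⊆ ys → Contains₃ R xs → Contains₃ R ys
Contains₃-resp-⊆ (v ∷ʳ xs⊆ys) c = skip (Contains₃-resp-⊆ xs⊆ys c)
Contains₃-resp-⊆ (refl ∷ xs⊆ys) (skip c) = skip (Contains₃-resp-⊆ xs⊆ys c)
Contains₃-resp-⊆ (refl ∷ xs⊆ys) (pick c) = pick (Contains₃After-resp-⊆ xs⊆ys c)

Is312 : ℕ → ℕ → ℕ → Set
Is312 y z u = z < u × u < y

Is132 : ℕ → ℕ → ℕ → Set
Is132 y z u = y < u × u < z

Within : (ℕ → ℕ) → (ℕ → ℕ → ℕ → Set) → ℕ → ℕ → ℕ → Set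
Within κ R y z u = R y z u × κ y ≡ κ z

Ascending∧312free : (ℕ → ℕ) → List ℕ → Set
Ascending∧312free κ w = AllPairs (λ y z → κ y ≤ κ z) w × ¬ Contains₃ (Within κ Is312) w

Descending∧132free : (ℕ → ℕ) → List ℕ → Set
Descending∧132free κ w = AllPairs (λ y z → κ z ≤ κ y) w × ¬ Contains₃ (Within κ Is132) w

module Blocks25b134 = BlockCriterion Is2534
  (λ (a<c , c<d , d<b) → <-trans a<c (<-trans c<d d<b)) proj₁ (λ a′≤a (a<c , rest) → ≤-<-trans a′≤a a<c , rest)

module Blocks23b154 = BlockCriterion Is2354
  proj₁ (λ (a<b , b<d , d<c) → <-trans a<b (<-trans b<d d<c)) (λ a′≤a (a<b , rest) → ≤-<-trans a′≤a a<b , rest)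

module BlockCharacterisation (m : ℕ) (ρ : List ℕ) where

  κ : ℕ → ℕ
  κ = rank ρ

  blockBad₂-25b134 : ∀ {y z w} → z ∈ w → Any (Is2534 m y z) ρ → Blocks25b134.BlockBad₂ m y w ρ
  blockBad₂-25b134 {w = _ ∷ w} (here refl) occ = Blocks25b134.pick (Anyₚ.++⁺ʳ w occ)
  blockBad₂-25b134 (there z∈) occ = Blocks25b134.skip (blockBad₂-25b134 z∈ occ)

  ¬BlockBad⇒ascending : ∀ w → All (m <_) w → All (_∉ ρ) w → ¬ Blocks25b134.BlockBad m w ρ →
                        AllPairs (λ y z → κ y ≤ κ z) w
  ¬BlockBad⇒ascending [] _ _ _ = []
  ¬BlockBad⇒ascending (y ∷ w) (_ ∷ m<w) (_ ∷ w∉ρ) good =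
    All.tabulate ordered ∷ ¬BlockBad⇒ascending w m<w w∉ρ (good ∘ Blocks25b134.skip)
    where
    ordered : ∀ {z} → z ∈ w → κ y ≤ κ z
    ordered {z} z∈ with κ y ≤? κ z
    ... | yes κy≤κz = κy≤κz
    ... | no κy≰κz with rank-gap ρ (≰⇒> κy≰κz)
    ...   | u , u∈ , z≤u , u<y with m≤n⇒m<n∨m≡n z≤u
    ...     | inj₂ refl = ⊥-elim (All.lookup w∉ρ z∈ u∈)
    ...     | inj₁ z<u = ⊥-elim (good (Blocks25b134.pick (blockBad₂-25b134 z∈ (lose u∈ (All.lookup m<w z∈ , z<u , u<y)))))

  312⇒BlockBad₂ : ∀ {y} w → All (m <_) w → Contains₃After (Within κ Is312) y w → Blocks25b134.BlockBad₂ m y w ρ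
  312⇒BlockBad₂ (v ∷ w) (_ ∷ m<w) (skip c) = Blocks25b134.skip (312⇒BlockBad₂ w m<w c)
  312⇒BlockBad₂ (z ∷ w) (m<z ∷ _) (pick occ) =
    Blocks25b134.pick (Anyₚ.++⁺ˡ (Any.map (λ ((z<u , u<y) , _) → m<z , z<u , u<y) occ))

  312⇒BlockBad : ∀ w → All (m <_) w → Contains₃ (Within κ Is312) w → Blocks25b134.BlockBad m w ρ
  312⇒BlockBad (v ∷ w) (_ ∷ m<w) (skip c) = Blocks25b134.skip (312⇒BlockBad w m<w c)
  312⇒BlockBad (y ∷ w) (_ ∷ m<w) (pick c) = Blocks25b134.pick (312⇒BlockBad₂ w m<w c)

  BlockBad₂⇒312 : ∀ {y} w → All (λ z → κ y ≤ κ z) w → Blocks25b134.BlockBad₂ m y w ρ →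
                  Contains₃After (Within κ Is312) y w
  BlockBad₂⇒312 (v ∷ w) (_ ∷ asc) (Blocks25b134.skip bad) = skip (BlockBad₂⇒312 w asc bad)
  BlockBad₂⇒312 (z ∷ w) (κy≤κz ∷ _) (Blocks25b134.pick occ) with Anyₚ.++⁻ w occ
  ... | inj₁ inW =
    pick (Any.map (λ (_ , z<u , u<y) → (z<u , u<y) , ≤-antisym κy≤κz (rank-mono ρ (<⇒≤ (<-trans z<u u<y)))) inW)
  ... | inj₂ inρ with find inρ
  ...   | u , u∈ , (_ , z<u , u<y) = ⊥-elim (<⇒≱ (rank-strict ρ u∈ (<⇒≤ z<u) u<y) κy≤κz)

  BlockBad⇒312 : ∀ w → AllPairs (λ y z → κ y ≤ κ z) w → Blocks25b134.BlockBad m w ρ → Contains₃ (Within κ Is312) w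
  BlockBad⇒312 (v ∷ w) (_ ∷ asc) (Blocks25b134.skip bad) = skip (BlockBad⇒312 w asc bad)
  BlockBad⇒312 (y ∷ w) (asc ∷ _) (Blocks25b134.pick bad) = pick (BlockBad₂⇒312 w asc bad)

  ¬BlockBad⇒Ascending∧312free : ∀ w → All (m <_) w → All (_∉ ρ) w → ¬ Blocks25b134.BlockBad m w ρ →
                                Ascending∧312free κ w
  ¬BlockBad⇒Ascending∧312free w m<w w∉ρ good =
    ¬BlockBad⇒ascending w m<w w∉ρ good , good ∘ 312⇒BlockBad w m<w

  Ascending∧312free⇒¬BlockBad : ∀ w → Ascending∧312free κ w → ¬ Blocks25b134.BlockBad m w ρ
  Ascending∧312free⇒¬BlockBad w (asc , free) = free ∘ BlockBad⇒312 w asc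

  blockBad₂-23b154 : ∀ {y z w} → z ∈ w → Any (Is2354 m y z) ρ → Blocks23b154.BlockBad₂ m y w ρ
  blockBad₂-23b154 {w = _ ∷ w} (here refl) occ = Blocks23b154.pick (Anyₚ.++⁺ʳ w occ)
  blockBad₂-23b154 (there z∈) occ = Blocks23b154.skip (blockBad₂-23b154 z∈ occ)

  ¬BlockBad⇒descending : ∀ w → All (m <_) w → All (_∉ ρ) w → ¬ Blocks23b154.BlockBad m w ρ →
                         AllPairs (λ y z → κ z ≤ κ y) w
  ¬BlockBad⇒descending [] _ _ _ = []
  ¬BlockBad⇒descending (y ∷ w) (m<y ∷ m<w) (y∉ρ ∷ w∉ρ) good =
    All.tabulate ordered ∷ ¬BlockBad⇒descending w m<w w∉ρ (good ∘ Blocks23b154.skip)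
    where
    ordered : ∀ {z} → z ∈ w → κ z ≤ κ y
    ordered {z} z∈ with κ z ≤? κ y
    ... | yes κz≤κy = κz≤κy
    ... | no κz≰κy with rank-gap ρ (≰⇒> κz≰κy)
    ...   | u , u∈ , y≤u , u<z with m≤n⇒m<n∨m≡n y≤u
    ...     | inj₂ refl = ⊥-elim (y∉ρ u∈)
    ...     | inj₁ y<u = ⊥-elim (good (Blocks23b154.pick (blockBad₂-23b154 z∈ (lose u∈ (m<y , y<u , u<z)))))

  132⇒BlockBad₂ : ∀ {y} w → m < y → Contains₃After (Within κ Is132) y w → Blocks23b154.BlockBad₂ m y w ρ
  132⇒BlockBad₂ (v ∷ w) m<y (skip c) = Blocks23b154.skip (132⇒BlockBad₂ w m<y c)
  132⇒BlockBad₂ (z ∷ w) m<y (pick occ) =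
    Blocks23b154.pick (Anyₚ.++⁺ˡ (Any.map (λ ((y<u , u<z) , _) → m<y , y<u , u<z) occ))

  132⇒BlockBad : ∀ w → All (m <_) w → Contains₃ (Within κ Is132) w → Blocks23b154.BlockBad m w ρ
  132⇒BlockBad (v ∷ w) (_ ∷ m<w) (skip c) = Blocks23b154.skip (132⇒BlockBad w m<w c)
  132⇒BlockBad (y ∷ w) (m<y ∷ _) (pick c) = Blocks23b154.pick (132⇒BlockBad₂ w m<y c)

  BlockBad₂⇒132 : ∀ {y} w → All (λ z → κ z ≤ κ y) w → Blocks23b154.BlockBad₂ m y w ρ →
                  Contains₃After (Within κ Is132) y w
  BlockBad₂⇒132 (v ∷ w) (_ ∷ desc) (Blocks23b154.skip bad) = skip (BlockBad₂⇒132 w desc bad)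
  BlockBad₂⇒132 (z ∷ w) (κz≤κy ∷ _) (Blocks23b154.pick occ) with Anyₚ.++⁻ w occ
  ... | inj₁ inW =
    pick (Any.map (λ (_ , y<u , u<z) → (y<u , u<z) , ≤-antisym (rank-mono ρ (<⇒≤ (<-trans y<u u<z))) κz≤κy) inW)
  ... | inj₂ inρ with find inρ
  ...   | u , u∈ , (_ , y<u , u<z) = ⊥-elim (<⇒≱ (rank-strict ρ u∈ (<⇒≤ y<u) u<z) κz≤κy)

  BlockBad⇒132 : ∀ w → AllPairs (λ y z → κ z ≤ κ y) w → Blocks23b154.BlockBad m w ρ → Contains₃ (Within κ Is132) w
  BlockBad⇒132 (v ∷ w) (_ ∷ desc) (Blocks23b154.skip bad) = skip (BlockBad⇒132 w desc bad)
  BlockBad⇒132 (y ∷ w) (desc ∷ _) (Blocks23b154.pick bad) = pick (BlockBad₂⇒132 w desc bad)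

  ¬BlockBad⇒Descending∧132free : ∀ w → All (m <_) w → All (_∉ ρ) w → ¬ Blocks23b154.BlockBad m w ρ →
                                 Descending∧132free κ w
  ¬BlockBad⇒Descending∧132free w m<w w∉ρ good =
    ¬BlockBad⇒descending w m<w w∉ρ good , good ∘ 132⇒BlockBad w m<w

  Descending∧132free⇒¬BlockBad : ∀ w → Descending∧132free κ w → ¬ Blocks23b154.BlockBad m w ρ
  Descending∧132free⇒¬BlockBad w (desc , free) = free ∘ BlockBad⇒132 w desc

-- Regrouping a block by rank

module Regrouping (κ : ℕ → ℕ) where

  classOf : ℕ → List ℕ → List ℕ
  classOf k = filter (λ x → κ x ≟ k)

  regroup : List ℕ → List ℕ → List ℕ
  regroup ks w = concatMap (λ k → classOf k w) ks

  transform : List ℕ → List ℕ → List ℕ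
  transform ks w = concatMap (λ k → complement (classOf k w)) ks

  classOf-unique : ∀ k {w} → Unique w → Unique (classOf k w)
  classOf-unique k = Uniqueₚ.filter⁺ (λ x → κ x ≟ k)

  complement-classOf-∈ : ∀ k {w} → Unique w → ∀ {z} → z ∈ complement (classOf k w) → z ∈ w × κ z ≡ k
  complement-classOf-∈ k {w} uw z∈ = ∈-filter⁻ (λ x → κ x ≟ k) {xs = w} (complement-∈ _ (classOf-unique k uw) z∈)

  transform-key : ∀ ks {w} → Unique w → ∀ {z} → z ∈ transform ks w → κ z ∈ ks
  transform-key (k ∷ ks) {w} uw z∈ with ∈-++⁻ (complement (classOf k w)) z∈
  ... | inj₁ z∈k = here (proj₂ (complement-classOf-∈ k uw z∈k))
  ... | inj₂ z∈ks = there (transform-key ks uw z∈ks)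

  regroup-[] : ∀ ks → regroup ks [] ≡ []
  regroup-[] [] = refl
  regroup-[] (k ∷ ks) = regroup-[] ks

  regroup-∷-absent : ∀ ks x w → κ x ∉ ks → regroup ks (x ∷ w) ≡ regroup ks w
  regroup-∷-absent [] x w _ = refl
  regroup-∷-absent (k ∷ ks) x w κx∉ =
    cong₂ _++_ (filter-reject (λ x → κ x ≟ k) (κx∉ ∘ here)) (regroup-∷-absent ks x w (κx∉ ∘ there))

  regroup-∷ : ∀ ks x w → Unique ks → κ x ∈ ks → regroup ks (x ∷ w) ↭ x ∷ regroup ks w
  regroup-∷ (k ∷ ks) x w (k∉ks ∷ _) (here κx≡k)
    rewrite filter-accept (λ x → κ x ≟ k) {xs = w} κx≡k
          | regroup-∷-absent ks x w (λ κx∈ → All.lookup k∉ks κx∈ (sym κx≡k)) = ↭-refl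
  regroup-∷ (k ∷ ks) x w (k∉ks ∷ uks) (there κx∈)
    rewrite filter-reject (λ x → κ x ≟ k) {xs = w} (λ κx≡k → All.lookup k∉ks κx∈ (sym κx≡k)) =
    ↭-trans (↭-++⁺ˡ (classOf k w) (regroup-∷ ks x w uks κx∈)) (shift x (classOf k w) (regroup ks w))

  regroup-↭ : ∀ ks w → Unique ks → (∀ {x} → x ∈ w → κ x ∈ ks) → regroup ks w ↭ w
  regroup-↭ ks [] _ _ rewrite regroup-[] ks = ↭-refl
  regroup-↭ ks (x ∷ w) uks keys =
    ↭-trans (regroup-∷ ks x w uks (keys (here refl))) (↭-prep x (regroup-↭ ks w uks (keys ∘ there)))

  transform-↭-regroup : ∀ ks {w} → Unique w → transform ks w ↭ regroup ks w
  transform-↭-regroup [] _ = ↭-refl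
  transform-↭-regroup (k ∷ ks) uw = ↭-++⁺ (complement-↭ _ (classOf-unique k uw)) (transform-↭-regroup ks uw)

  transform-↭ : ∀ ks w → Unique ks → Unique w → (∀ {x} → x ∈ w → κ x ∈ ks) → transform ks w ↭ w
  transform-↭ ks w uks uw keys = ↭-trans (transform-↭-regroup ks uw) (regroup-↭ ks w uks keys)

  module _ {Lt Le : ℕ → ℕ → Set} (Le-refl : ∀ {a} → Le a a)
           (separated : ∀ {k j i} → Lt k j → Le j i → i ≢ k) where

    regroup-∷-first : ∀ ks x w → AllPairs Lt ks → κ x ∈ ks → All (λ z → Le (κ x) (κ z)) w →
                      regroup ks (x ∷ w) ≡ x ∷ regroup ks w
    regroup-∷-first (k ∷ ks) x w (k<ks ∷ _) (here κx≡k) _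
      rewrite filter-accept (λ x → κ x ≟ k) {xs = w} κx≡k
            | regroup-∷-absent ks x w (λ κx∈ → separated (All.lookup k<ks κx∈) Le-refl κx≡k) = refl
    regroup-∷-first (k ∷ ks) x w (k<ks ∷ ks↗) (there κx∈) x≤w
      rewrite filter-reject (λ x → κ x ≟ k) {xs = w} (separated (All.lookup k<ks κx∈) Le-refl)
            | filter-none (λ x → κ x ≟ k) (All.map (separated (All.lookup k<ks κx∈)) x≤w)
            | regroup-∷-first ks x w ks↗ κx∈ x≤w = refl

    regroup-sorted : ∀ ks w → AllPairs Lt ks → (∀ {x} → x ∈ w → κ x ∈ ks) →
                     AllPairs (λ y z → Le (κ y) (κ z)) w → regroup ks w ≡ w
    regroup-sorted ks [] _ _ _ = regroup-[] ks
    regroup-sorted ks (x ∷ w) ks↗ keys (x≤w ∷ w↗)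
      rewrite regroup-∷-first ks x w ks↗ (keys (here refl)) x≤w =
      cong (x ∷_) (regroup-sorted ks w ks↗ (keys ∘ there) w↗)

  classOf-transform : ∀ ks k {w} → Unique ks → Unique w → k ∈ ks →
                      classOf k (transform ks w) ≡ complement (classOf k w)
  classOf-transform (j ∷ ks) k {w} (j∉ks ∷ uks) uw k∈
    rewrite filter-++ (λ x → κ x ≟ k) (complement (classOf j w)) (transform ks w) with k∈
  ... | here refl
    rewrite filter-all (λ x → κ x ≟ k) (All.tabulate (proj₂ ∘ complement-classOf-∈ k uw))
          | filter-none (λ x → κ x ≟ k) {xs = transform ks w}
              (All.tabulate λ z∈ κz≡k → All.lookup j∉ks (transform-key ks uw z∈) (sym κz≡k)) = ++-identityʳ _
  ... | there k∈ks
    rewrite filter-none (λ x → κ x ≟ k) {xs = complement (classOf j w)}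
              (All.tabulate λ z∈ κz≡k → All.lookup j∉ks k∈ks (trans (sym (proj₂ (complement-classOf-∈ j uw z∈))) κz≡k)) =
    classOf-transform ks k uks uw k∈ks

  transform-transform : ∀ ks′ ks w → Unique ks → Unique w → (∀ {k} → k ∈ ks′ → k ∈ ks) →
                        transform ks′ (transform ks w) ≡ regroup ks′ w
  transform-transform [] ks w _ _ _ = refl
  transform-transform (k ∷ ks′) ks w uks uw ks′⊆ks =
    cong₂ _++_ (trans (cong complement (classOf-transform ks k uks uw (ks′⊆ks (here refl))))
                      (complement-involutive (classOf k w) (classOf-unique k uw)))
               (transform-transform ks′ ks w uks uw (ks′⊆ks ∘ there))

  transform-sorted : ∀ {Lt S : ℕ → ℕ → Set} → (∀ {a} → S a a) → (∀ {k j} → Lt k j → S k j) →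
                     ∀ ks {w} → AllPairs Lt ks → Unique w → AllPairs (λ y z → S (κ y) (κ z)) (transform ks w)
  transform-sorted S-refl Lt⇒S [] _ _ = []
  transform-sorted {S = S} S-refl Lt⇒S (k ∷ ks) {w} (k<ks ∷ ks↗) uw =
    AllPairsₚ.++⁺ (sameClass (All.tabulate (proj₂ ∘ complement-classOf-∈ k uw)))
                  (transform-sorted S-refl Lt⇒S ks ks↗ uw)
                  (All.tabulate λ y∈ → All.tabulate λ z∈ →
                    subst (λ a → S a _) (sym (proj₂ (complement-classOf-∈ k uw y∈)))
                          (Lt⇒S (All.lookup k<ks (transform-key ks uw z∈))))
    where
    sameClass : ∀ {xs} → All (λ z → κ z ≡ k) xs → AllPairs (λ y z → S (κ y) (κ z)) xs
    sameClass [] = []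
    sameClass (κx≡k ∷ κxs≡k) =
      All.map (λ κz≡k → subst₂ S (sym κx≡k) (sym κz≡k) S-refl) κxs≡k ∷ sameClass κxs≡k

  module _ {R : ℕ → ℕ → ℕ → Set} (closed : ∀ {y z u} → R y z u → κ z ≡ κ y × κ u ≡ κ y) where

    Contains₃After-++⁻ : ∀ k {y} xs ys → κ y ≡ k → All (λ z → κ z ≡ k) xs → All (λ z → κ z ≢ k) ys →
                         Contains₃After R y (xs ++ ys) → Contains₃After R y xs
    Contains₃After-++⁻ k [] (z ∷ ys) κy≡k _ (κz≢k ∷ _) (pick occ) =
      ⊥-elim (κz≢k (trans (proj₁ (closed (proj₂ (Any.satisfied occ)))) κy≡k))
    Contains₃After-++⁻ k [] (z ∷ ys) κy≡k _ (_ ∷ κys≢k) (skip c) = Contains₃After-++⁻ k [] ys κy≡k [] κys≢k c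
    Contains₃After-++⁻ k (x ∷ xs) ys κy≡k (_ ∷ κxs≡k) κys≢k (skip c) =
      skip (Contains₃After-++⁻ k xs ys κy≡k κxs≡k κys≢k c)
    Contains₃After-++⁻ k (x ∷ xs) ys κy≡k _ κys≢k (pick occ) with Anyₚ.++⁻ xs occ
    ... | inj₁ inXs = pick inXs
    ... | inj₂ inYs = let u , u∈ , r = find inYs in ⊥-elim (All.lookup κys≢k u∈ (trans (proj₂ (closed r)) κy≡k))

    Contains₃-++⁻ : ∀ k xs ys → All (λ z → κ z ≡ k) xs → All (λ z → κ z ≢ k) ys →
                    Contains₃ R (xs ++ ys) → Contains₃ R xs ⊎ Contains₃ R ys
    Contains₃-++⁻ k [] ys _ _ c = inj₂ c
    Contains₃-++⁻ k (x ∷ xs) ys (_ ∷ κxs≡k) κys≢k (skip c) with Contains₃-++⁻ k xs ys κxs≡k κys≢k c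
    ... | inj₁ cxs = inj₁ (skip cxs)
    ... | inj₂ cys = inj₂ cys
    Contains₃-++⁻ k (x ∷ xs) ys (κx≡k ∷ κxs≡k) κys≢k (pick c) =
      inj₁ (pick (Contains₃After-++⁻ k xs ys κx≡k κxs≡k κys≢k c))

    Contains₃-transform : ∀ ks {w} → Unique ks → Unique w → Contains₃ R (transform ks w) →
                          ∃[ k ] Contains₃ R (complement (classOf k w))
    Contains₃-transform (k ∷ ks) {w} (k∉ks ∷ uks) uw c
      with Contains₃-++⁻ k (complement (classOf k w)) (transform ks w)
             (All.tabulate (proj₂ ∘ complement-classOf-∈ k uw))
             (All.tabulate λ z∈ κz≡k → All.lookup k∉ks (transform-key ks uw z∈) (sym κz≡k)) c
    ... | inj₁ inClass = k , inClass
    ... | inj₂ later = Contains₃-transform ks uks uw later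

  transfer : ∀ {Rs Rt : ℕ → ℕ → ℕ → Set} → (∀ {y z u} → Rt y z u → κ z ≡ κ y × κ u ≡ κ y) →
             (∀ P → Unique P → ∀ {a b c} → a ∈ P → b ∈ P → c ∈ P → κ a ≡ κ b →
                Rt (mirror P a) (mirror P b) (mirror P c) → Rs a b c) →
             ∀ ks {w} → Unique ks → Unique w → Contains₃ Rt (transform ks w) → Contains₃ Rs w
  transfer {Rs} {Rt} closed mirror-Rt ks {w} uks uw c with Contains₃-transform closed ks uks uw c
  ... | k , ck = Contains₃-resp-⊆ (filter-⊆ (λ x → κ x ≟ k) w)
    (Contains₃-mono (All.tabulate id) rs (Contains₃-map⁻ (mirror (classOf k w)) (classOf k w) ck))
    where
    rs : ∀ {a b c} → a ∈ classOf k w → b ∈ classOf k w → c ∈ classOf k w →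
         Rt (mirror (classOf k w) a) (mirror (classOf k w) b) (mirror (classOf k w) c) → Rs a b c
    rs a∈ b∈ c∈ = mirror-Rt (classOf k w) (classOf-unique k uw) a∈ b∈ c∈
      (trans (proj₂ (∈-filter⁻ (λ x → κ x ≟ k) {xs = w} a∈)) (sym (proj₂ (∈-filter⁻ (λ x → κ x ≟ k) {xs = w} b∈))))

transform-cong : ∀ {κ κ′ : ℕ → ℕ} → (∀ x → κ x ≡ κ′ x) → ∀ ks w →
                 Regrouping.transform κ ks w ≡ Regrouping.transform κ′ ks w
transform-cong e [] w = refl
transform-cong {κ} {κ′} e (k ∷ ks) w =
  cong₂ _++_ (cong complement (filter-≐ (λ x → κ x ≟ k) (λ x → κ′ x ≟ k) ((λ {x} → trans (sym (e x))) , (λ {x} → trans (e x))) w))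
             (transform-cong e ks w)

Within-cong : ∀ {κ κ′ : ℕ → ℕ} {R y z u} → (∀ x → κ x ≡ κ′ x) → Within κ R y z u → Within κ′ R y z u
Within-cong {y = y} {z} e (r , κy≡κz) = r , trans (sym (e y)) (trans κy≡κz (e z))

Descending∧132free-cong : ∀ {κ κ′ : ℕ → ℕ} → (∀ x → κ x ≡ κ′ x) → ∀ {w} → Descending∧132free κ w → Descending∧132free κ′ w
Descending∧132free-cong e {w} (desc , free) =
  AllPairs.map (λ {y} {z} → subst₂ _≤_ (e z) (e y)) desc ,
  free ∘ Contains₃-mono (All.universal (λ _ → tt) w) (λ _ _ _ → Within-cong {R = Is132} (sym ∘ e))

Ascending∧312free-cong : ∀ {κ κ′ : ℕ → ℕ} → (∀ x → κ x ≡ κ′ x) → ∀ {w} → Ascending∧312free κ w → Ascending∧312free κ′ w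
Ascending∧312free-cong e {w} (asc , free) =
  AllPairs.map (λ {y} {z} → subst₂ _≤_ (e y) (e z)) asc ,
  free ∘ Contains₃-mono (All.universal (λ _ → tt) w) (λ _ _ _ → Within-cong {R = Is312} (sym ∘ e))

rank∈downFrom : ∀ ρ x → rank ρ x ∈ downFrom (suc (length ρ))
rank∈downFrom ρ x = ∈-downFrom⁺ (s≤s (rank≤length ρ x))

rank∈upTo : ∀ ρ x → rank ρ x ∈ upTo (suc (length ρ))
rank∈upTo ρ x = ∈-upTo⁺ (s≤s (rank≤length ρ x))

downFrom-descending : ∀ n → AllPairs _>_ (downFrom n)
downFrom-descending n = AllPairsₚ.applyDownFrom⁺₁ id n (λ j<i _ → j<i)

upTo-ascending : ∀ n → AllPairs _<_ (upTo n)
upTo-ascending n = AllPairsₚ.applyUpTo⁺₁ id n (λ i<j _ → i<j)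

downFrom-unique : ∀ n → Unique (downFrom n)
downFrom-unique n = AllPairs.map >⇒≢ (downFrom-descending n)

upTo-unique : ∀ n → Unique (upTo n)
upTo-unique n = AllPairs.map <⇒≢ (upTo-ascending n)

toDescending : List ℕ → List ℕ → List ℕ
toDescending ρ = Regrouping.transform (rank ρ) (downFrom (suc (length ρ)))

toAscending : List ℕ → List ℕ → List ℕ
toAscending ρ = Regrouping.transform (rank ρ) (upTo (suc (length ρ)))

Is312-closed : ∀ ρ {y z u} → Within (rank ρ) Is312 y z u → rank ρ z ≡ rank ρ y × rank ρ u ≡ rank ρ y
Is312-closed ρ ((z<u , u<y) , κy≡κz) =
  sym κy≡κz , ≤-antisym (rank-mono ρ (<⇒≤ u<y)) (subst (_≤ rank ρ _) (sym κy≡κz) (rank-mono ρ (<⇒≤ z<u)))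

Is132-closed : ∀ ρ {y z u} → Within (rank ρ) Is132 y z u → rank ρ z ≡ rank ρ y × rank ρ u ≡ rank ρ y
Is132-closed ρ ((y<u , u<z) , κy≡κz) =
  sym κy≡κz , ≤-antisym (subst (rank ρ _ ≤_) (sym κy≡κz) (rank-mono ρ (<⇒≤ u<z))) (rank-mono ρ (<⇒≤ y<u))

toDescending-↭ : ∀ ρ {w} → Unique w → toDescending ρ w ↭ w
toDescending-↭ ρ {w} uw =
  Regrouping.transform-↭ (rank ρ) _ w (downFrom-unique _) uw (λ {x} _ → rank∈downFrom ρ x)

toAscending-↭ : ∀ ρ {w} → Unique w → toAscending ρ w ↭ w
toAscending-↭ ρ {w} uw =
  Regrouping.transform-↭ (rank ρ) _ w (upTo-unique _) uw (λ {x} _ → rank∈upTo ρ x)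

toDescending-resp-↭ : ∀ {ρ ρ′} → ρ ↭ ρ′ → ∀ w → toDescending ρ w ≡ toDescending ρ′ w
toDescending-resp-↭ {ρ} {ρ′} ρ↭ρ′ w rewrite ↭-length ρ↭ρ′ =
  transform-cong (λ x → rank-↭ x ρ↭ρ′) (downFrom (suc (length ρ′))) w

toAscending-resp-↭ : ∀ {ρ ρ′} → ρ ↭ ρ′ → ∀ w → toAscending ρ w ≡ toAscending ρ′ w
toAscending-resp-↭ {ρ} {ρ′} ρ↭ρ′ w rewrite ↭-length ρ↭ρ′ =
  transform-cong (λ x → rank-↭ x ρ↭ρ′) (upTo (suc (length ρ′))) w

toDescending-Descending∧132free : ∀ ρ {w} → Unique w → Ascending∧312free (rank ρ) w →
                                  Descending∧132free (rank ρ) (toDescending ρ w)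
toDescending-Descending∧132free ρ uw (_ , free) =
  Regrouping.transform-sorted (rank ρ) ≤-refl <⇒≤ (downFrom (suc (length ρ))) (downFrom-descending _) uw ,
  free ∘ Regrouping.transfer (rank ρ) (Is132-closed ρ)
    (λ P uP a∈ b∈ c∈ κa≡κb ((ma<mc , mc<mb) , _) →
      (mirror⁻¹ P uP c∈ b∈ mc<mb , mirror⁻¹ P uP a∈ c∈ ma<mc) , κa≡κb)
    (downFrom (suc (length ρ))) (downFrom-unique _) uw

toAscending-Ascending∧312free : ∀ ρ {w} → Unique w → Descending∧132free (rank ρ) w →
                                Ascending∧312free (rank ρ) (toAscending ρ w)
toAscending-Ascending∧312free ρ uw (_ , free) =
  Regrouping.transform-sorted (rank ρ) ≤-refl <⇒≤ (upTo (suc (length ρ))) (upTo-ascending _) uw ,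
  free ∘ Regrouping.transfer (rank ρ) (Is312-closed ρ)
    (λ P uP a∈ b∈ c∈ κa≡κb ((mb<mc , mc<ma) , _) →
      (mirror⁻¹ P uP c∈ a∈ mc<ma , mirror⁻¹ P uP b∈ c∈ mb<mc) , κa≡κb)
    (upTo (suc (length ρ))) (upTo-unique _) uw

toAscending∘toDescending : ∀ ρ {w} → Unique w → AllPairs (λ y z → rank ρ y ≤ rank ρ z) w →
                           toAscending ρ (toDescending ρ w) ≡ w
toAscending∘toDescending ρ {w} uw asc = trans
  (Regrouping.transform-transform (rank ρ) (upTo _) (downFrom _) w (downFrom-unique _) uw (∈-downFrom⁺ ∘ ∈-upTo⁻))
  (Regrouping.regroup-sorted (rank ρ) ≤-refl (λ k<j j≤i i≡k → <-irrefl (sym i≡k) (<-≤-trans k<j j≤i))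
    (upTo _) w (upTo-ascending _) (λ {x} _ → rank∈upTo ρ x) asc)

toDescending∘toAscending : ∀ ρ {w} → Unique w → AllPairs (λ y z → rank ρ z ≤ rank ρ y) w →
                           toDescending ρ (toAscending ρ w) ≡ w
toDescending∘toAscending ρ {w} uw desc = trans
  (Regrouping.transform-transform (rank ρ) (downFrom _) (upTo _) w (upTo-unique _) uw (∈-upTo⁺ ∘ ∈-downFrom⁻))
  (Regrouping.regroup-sorted (rank ρ) ≤-refl (λ j<k i≤j i≡k → <-irrefl i≡k (≤-<-trans i≤j j<k))
    (downFrom _) w (downFrom-descending _) (λ {x} _ → rank∈downFrom ρ x) desc)

-- The bijection

Unique-++⁻ : ∀ w {ρ : List ℕ} → Unique (w ++ ρ) → Unique w × All (_∉ ρ) w × Unique ρ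
Unique-++⁻ [] uρ = [] , [] , uρ
Unique-++⁻ (x ∷ w) (x∉ ∷ u) =
  let uw , w∉ρ , uρ = Unique-++⁻ w u
  in ++⁻ˡ w x∉ ∷ uw , (λ x∈ρ → All.lookup (++⁻ʳ w x∉) x∈ρ refl) ∷ w∉ρ , uρ

mapBlocks : (List ℕ → List ℕ → List ℕ) → List Block → List Block
mapBlocks t [] = []
mapBlocks t ((m , w) ∷ bs) = (m , t (flatten bs) w) ∷ mapBlocks t bs

module BlockMap (t : List ℕ → List ℕ → List ℕ) (t-↭ : ∀ ρ {w} → Unique w → t ρ w ↭ w) where

  flatten-mapBlocks-↭ : ∀ bs → Unique (flatten bs) → flatten (mapBlocks t bs) ↭ flatten bs
  flatten-mapBlocks-↭ [] _ = ↭-refl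
  flatten-mapBlocks-↭ ((m , w) ∷ bs) (_ ∷ u) =
    let uw , _ , uρ = Unique-++⁻ w u in ↭-prep m (↭-++⁺ (t-↭ _ uw) (flatten-mapBlocks-↭ bs uρ))

  HeadBelow-mapBlocks : ∀ {m} bs → HeadBelow m bs → HeadBelow m (mapBlocks t bs)
  HeadBelow-mapBlocks [] _ = tt
  HeadBelow-mapBlocks (_ ∷ _) hb = hb

  mapBlocks-LRMin : ∀ bs → LRMinBlocks bs → Unique (flatten bs) → LRMinBlocks (mapBlocks t bs)
  mapBlocks-LRMin [] _ _ = tt
  mapBlocks-LRMin ((m , w) ∷ bs) (m<w , hb , lr) (_ ∷ u) =
    let uw , _ , uρ = Unique-++⁻ w u
    in All-resp-↭ (↭-sym (t-↭ _ uw)) m<w , HeadBelow-mapBlocks bs hb , mapBlocks-LRMin bs lr uρ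

  mapBlocks-Every : ∀ {Q Q′ : ℕ → List ℕ → List ℕ → Set} →
    (∀ {m w ρ ρ′} → All (m <_) w → Unique w → All (_∉ ρ) w → ρ′ ↭ ρ → Q m w ρ → Q′ m (t ρ w) ρ′) →
    ∀ bs → LRMinBlocks bs → Unique (flatten bs) → EveryBlock Q bs → EveryBlock Q′ (mapBlocks t bs)
  mapBlocks-Every step [] _ _ _ = tt
  mapBlocks-Every step ((m , w) ∷ bs) (m<w , _ , lr) (_ ∷ u) (q , qs) =
    let uw , w∉ρ , uρ = Unique-++⁻ w u
    in step m<w uw w∉ρ (flatten-mapBlocks-↭ bs uρ) q , mapBlocks-Every step bs lr uρ qs

  mapBlocks-inverse : ∀ {Q : ℕ → List ℕ → List ℕ → Set} (t′ : List ℕ → List ℕ → List ℕ) →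
    (∀ {m w ρ ρ′} → All (m <_) w → Unique w → All (_∉ ρ) w → ρ′ ↭ ρ → Q m w ρ → t′ ρ′ (t ρ w) ≡ w) →
    ∀ bs → LRMinBlocks bs → Unique (flatten bs) → EveryBlock Q bs → mapBlocks t′ (mapBlocks t bs) ≡ bs
  mapBlocks-inverse t′ inverse [] _ _ _ = refl
  mapBlocks-inverse t′ inverse ((m , w) ∷ bs) (m<w , _ , lr) (_ ∷ u) (q , qs) =
    let uw , w∉ρ , uρ = Unique-++⁻ w u
    in cong₂ (λ w′ bs′ → (m , w′) ∷ bs′) (inverse m<w uw w∉ρ (flatten-mapBlocks-↭ bs uρ) q)
                                         (mapBlocks-inverse t′ inverse bs lr uρ qs)

module Avoiding25b134 = ThirdLetterBarred 2 5 1 3 4 Is2534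
  (λ a b c d → orderIso⇒2534 {a} {b} {c} {d}) (λ _ _ _ _ → 2534⇒orderIso)
  (λ a b e c d → orderIso⇒third<first {a} {b} {e} {c} {d} (2 ∷ 5 ∷ 1 ∷ 3 ∷ 4 ∷ []))
  (λ _ _ _ _ _ → 25134⇒orderIso)

module Avoiding23b154 = ThirdLetterBarred 2 3 1 5 4 Is2354
  (λ a b c d → orderIso⇒2354 {a} {b} {c} {d}) (λ _ _ _ _ → 2354⇒orderIso)
  (λ a b e c d → orderIso⇒third<first {a} {b} {e} {c} {d} (2 ∷ 3 ∷ 1 ∷ 5 ∷ 4 ∷ []))
  (λ _ _ _ _ _ → 23154⇒orderIso)

avoids⇒GoodBlocks-25b134 : ∀ π → Unique π → T (avoids p25b134 π) → Blocks25b134.GoodBlocks (blocks π)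
avoids⇒GoodBlocks-25b134 π uπ av = Blocks25b134.¬Bad⇒GoodBlocks (blocks π) (blocks-LRMin π uπ) λ bad →
  Blocks25b134.Bad⇒¬BarAvoids _ bad (subst (BarAvoids Is2534) (sym (flatten-blocks π)) (Avoiding25b134.avoids⇒BarAvoids π av))

avoids⇒GoodBlocks-23b154 : ∀ π → Unique π → T (avoids p23b154 π) → Blocks23b154.GoodBlocks (blocks π)
avoids⇒GoodBlocks-23b154 π uπ av = Blocks23b154.¬Bad⇒GoodBlocks (blocks π) (blocks-LRMin π uπ) λ bad →
  Blocks23b154.Bad⇒¬BarAvoids _ bad (subst (BarAvoids Is2354) (sym (flatten-blocks π)) (Avoiding23b154.avoids⇒BarAvoids π av))

GoodBlocks⇒avoids-25b134 : ∀ bs → LRMinBlocks bs → Blocks25b134.GoodBlocks bs → T (avoids p25b134 (flatten bs))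
GoodBlocks⇒avoids-25b134 bs lr good =
  Avoiding25b134.BarAvoids⇒avoids (flatten bs) (Blocks25b134.¬Bad⇒BarAvoids (flatten bs) (Blocks25b134.GoodBlocks⇒¬Bad bs lr good))

GoodBlocks⇒avoids-23b154 : ∀ bs → LRMinBlocks bs → Blocks23b154.GoodBlocks bs → T (avoids p23b154 (flatten bs))
GoodBlocks⇒avoids-23b154 bs lr good =
  Avoiding23b154.BarAvoids⇒avoids (flatten bs) (Blocks23b154.¬Bad⇒BarAvoids (flatten bs) (Blocks23b154.GoodBlocks⇒¬Bad bs lr good))

toDescending-good : ∀ {m w ρ ρ′} → All (m <_) w → Unique w → All (_∉ ρ) w → ρ′ ↭ ρ →
                    ¬ Blocks25b134.BlockBad m w ρ → ¬ Blocks23b154.BlockBad m (toDescending ρ w) ρ′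
toDescending-good {m} {w} {ρ} {ρ′} m<w uw w∉ρ ρ′↭ρ good =
  BlockCharacterisation.Descending∧132free⇒¬BlockBad m ρ′ (toDescending ρ w)
    (Descending∧132free-cong (λ x → rank-↭ x (↭-sym ρ′↭ρ))
      (toDescending-Descending∧132free ρ uw (BlockCharacterisation.¬BlockBad⇒Ascending∧312free m ρ w m<w w∉ρ good)))

toAscending-good : ∀ {m w ρ ρ′} → All (m <_) w → Unique w → All (_∉ ρ) w → ρ′ ↭ ρ →
                   ¬ Blocks23b154.BlockBad m w ρ → ¬ Blocks25b134.BlockBad m (toAscending ρ w) ρ′
toAscending-good {m} {w} {ρ} {ρ′} m<w uw w∉ρ ρ′↭ρ good =
  BlockCharacterisation.Ascending∧312free⇒¬BlockBad m ρ′ (toAscending ρ w)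
    (Ascending∧312free-cong (λ x → rank-↭ x (↭-sym ρ′↭ρ))
      (toAscending-Ascending∧312free ρ uw (BlockCharacterisation.¬BlockBad⇒Descending∧132free m ρ w m<w w∉ρ good)))

toAscending-toDescending-block : ∀ {m w ρ ρ′} → All (m <_) w → Unique w → All (_∉ ρ) w → ρ′ ↭ ρ →
                                 ¬ Blocks25b134.BlockBad m w ρ → toAscending ρ′ (toDescending ρ w) ≡ w
toAscending-toDescending-block {m} {w} {ρ} m<w uw w∉ρ ρ′↭ρ good =
  trans (toAscending-resp-↭ ρ′↭ρ (toDescending ρ w))
        (toAscending∘toDescending ρ uw (proj₁ (BlockCharacterisation.¬BlockBad⇒Ascending∧312free m ρ w m<w w∉ρ good)))

toDescending-toAscending-block : ∀ {m w ρ ρ′} → All (m <_) w → Unique w → All (_∉ ρ) w → ρ′ ↭ ρ →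
                                 ¬ Blocks23b154.BlockBad m w ρ → toDescending ρ′ (toAscending ρ w) ≡ w
toDescending-toAscending-block {m} {w} {ρ} m<w uw w∉ρ ρ′↭ρ good =
  trans (toDescending-resp-↭ ρ′↭ρ (toAscending ρ w))
        (toDescending∘toAscending ρ uw (proj₁ (BlockCharacterisation.¬BlockBad⇒Descending∧132free m ρ w m<w w∉ρ good)))

module MapToDescending = BlockMap toDescending toDescending-↭
module MapToAscending = BlockMap toAscending toAscending-↭

to23b154 : List ℕ → List ℕ
to23b154 π = flatten (mapBlocks toDescending (blocks π))

to25b134 : List ℕ → List ℕ
to25b134 π = flatten (mapBlocks toAscending (blocks π))

Unique-blocks : ∀ {π} → Unique π → Unique (flatten (blocks π))
Unique-blocks {π} = subst Unique (sym (flatten-blocks π))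

to23b154-↭ : ∀ {π} → Unique π → to23b154 π ↭ π
to23b154-↭ {π} uπ = subst (to23b154 π ↭_) (flatten-blocks π) (MapToDescending.flatten-mapBlocks-↭ (blocks π) (Unique-blocks uπ))

to25b134-↭ : ∀ {π} → Unique π → to25b134 π ↭ π
to25b134-↭ {π} uπ = subst (to25b134 π ↭_) (flatten-blocks π) (MapToAscending.flatten-mapBlocks-↭ (blocks π) (Unique-blocks uπ))

to23b154-avoids : ∀ {π} → Unique π → T (avoids p25b134 π) → T (avoids p23b154 (to23b154 π))
to23b154-avoids {π} uπ av = GoodBlocks⇒avoids-23b154 _
  (MapToDescending.mapBlocks-LRMin (blocks π) (blocks-LRMin π uπ) (Unique-blocks uπ))
  (MapToDescending.mapBlocks-Every toDescending-good (blocks π) (blocks-LRMin π uπ) (Unique-blocks uπ) (avoids⇒GoodBlocks-25b134 π uπ av))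

to25b134-avoids : ∀ {π} → Unique π → T (avoids p23b154 π) → T (avoids p25b134 (to25b134 π))
to25b134-avoids {π} uπ av = GoodBlocks⇒avoids-25b134 _
  (MapToAscending.mapBlocks-LRMin (blocks π) (blocks-LRMin π uπ) (Unique-blocks uπ))
  (MapToAscending.mapBlocks-Every toAscending-good (blocks π) (blocks-LRMin π uπ) (Unique-blocks uπ) (avoids⇒GoodBlocks-23b154 π uπ av))

to25b134∘to23b154 : ∀ {π} → Unique π → T (avoids p25b134 π) → to25b134 (to23b154 π) ≡ π
to25b134∘to23b154 {π} uπ av = begin
  flatten (mapBlocks toAscending (blocks (flatten (mapBlocks toDescending (blocks π)))))
    ≡⟨ cong (flatten ∘ mapBlocks toAscending) (blocks-flatten _ (MapToDescending.mapBlocks-LRMin (blocks π) lr uπ′)) ⟩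
  flatten (mapBlocks toAscending (mapBlocks toDescending (blocks π)))
    ≡⟨ cong flatten (MapToDescending.mapBlocks-inverse toAscending toAscending-toDescending-block (blocks π) lr uπ′
                       (avoids⇒GoodBlocks-25b134 π uπ av)) ⟩
  flatten (blocks π)
    ≡⟨ flatten-blocks π ⟩
  π ∎
  where
  open ≡-Reasoning
  lr : LRMinBlocks (blocks π)
  lr = blocks-LRMin π uπ
  uπ′ : Unique (flatten (blocks π))
  uπ′ = Unique-blocks uπ

to23b154∘to25b134 : ∀ {π} → Unique π → T (avoids p23b154 π) → to23b154 (to25b134 π) ≡ π
to23b154∘to25b134 {π} uπ av = begin
  flatten (mapBlocks toDescending (blocks (flatten (mapBlocks toAscending (blocks π)))))
    ≡⟨ cong (flatten ∘ mapBlocks toDescending) (blocks-flatten _ (MapToAscending.mapBlocks-LRMin (blocks π) lr uπ′)) ⟩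
  flatten (mapBlocks toDescending (mapBlocks toAscending (blocks π)))
    ≡⟨ cong flatten (MapToAscending.mapBlocks-inverse toDescending toDescending-toAscending-block (blocks π) lr uπ′
                       (avoids⇒GoodBlocks-23b154 π uπ av)) ⟩
  flatten (blocks π)
    ≡⟨ flatten-blocks π ⟩
  π ∎
  where
  open ≡-Reasoning
  lr : LRMinBlocks (blocks π)
  lr = blocks-LRMin π uπ
  uπ′ : Unique (flatten (blocks π))
  uπ′ = Unique-blocks uπ

length-≡-by-inverses : ∀ {A : Set} {xs ys : List A} (f g : A → A) → Unique xs → Unique ys →
                       (∀ {x} → x ∈ xs → f x ∈ ys) → (∀ {y} → y ∈ ys → g y ∈ xs) →
                       (∀ {x} → x ∈ xs → g (f x) ≡ x) → (∀ {y} → y ∈ ys → f (g y) ≡ y) →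
                       length xs ≡ length ys
length-≡-by-inverses {xs = xs} {ys} f g uxs uys f∈ g∈ gf fg =
  trans (sym (length-map f xs)) (↭-length (∼bag⇒↭ (unique∧set⇒bag unique uys (mk⇔ to from))))
  where
  unique : Unique (map f xs)
  unique = Unique-map-local f xs uxs λ x∈ x′∈ fx≡fx′ → trans (sym (gf x∈)) (trans (cong g fx≡fx′) (gf x′∈))
  to : ∀ {y} → y ∈ map f xs → y ∈ ys
  to y∈ with ∈-map⁻ f y∈
  ... | x , x∈ , refl = f∈ x∈
  from : ∀ {y} → y ∈ ys → y ∈ map f xs
  from y∈ = subst (_∈ map f xs) (fg y∈) (∈-map⁺ f (g∈ y∈))

distinct⇒Unique : ∀ w → T (distinct w) → Unique w
distinct⇒Unique [] _ = []
distinct⇒Unique (x ∷ w) h =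
  let fresh , rest = Equivalence.to T-∧ h
  in All.tabulate (λ y∈ x≡y → Equivalence.to T-not⇔¬T fresh (any⁺ (x ≡ᵇ_) (lose y∈ (≡⇒≡ᵇ x _ x≡y)))) ∷
     distinct⇒Unique w rest

Unique⇒distinct : ∀ w → Unique w → T (distinct w)
Unique⇒distinct [] _ = tt
Unique⇒distinct (x ∷ w) (x∉ ∷ uw) = Equivalence.from T-∧ (Equivalence.from T-not⇔¬T fresh , Unique⇒distinct w uw)
  where
  fresh : ¬ T (any (x ≡ᵇ_) w)
  fresh hit = let y , y∈ , x≡ᵇy = find (any⁻ (x ≡ᵇ_) w hit) in All.lookup x∉ y∈ (≡ᵇ⇒≡ x y x≡ᵇy)

∈-words⁻ : ∀ n k {w} → w ∈ words n k → length w ≡ k × All (_∈ applyUpTo suc n) w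
∈-words⁻ n zero (here refl) = refl , []
∈-words⁻ n (suc k) w∈ with find (∈-concatMap⁻ (λ v → map (_∷ v) (applyUpTo suc n)) {xs = words n k} w∈)
... | v , v∈ , w∈′ with ∈-map⁻ (_∷ v) w∈′
...   | x , x∈ , refl = let len , letters = ∈-words⁻ n k v∈ in cong suc len , x∈ ∷ letters

∈-words⁺ : ∀ n {w} → All (_∈ applyUpTo suc n) w → w ∈ words n (length w)
∈-words⁺ n [] = here refl
∈-words⁺ n {x ∷ w} (x∈ ∷ letters) =
  ∈-concatMap⁺ (λ v → map (_∷ v) (applyUpTo suc n)) (lose (∈-words⁺ n letters) (∈-map⁺ (_∷ w) x∈))

words-unique : ∀ n k → Unique (words n k)
words-unique n zero = [] ∷ []
words-unique n (suc k) = Uniqueₚ.concat⁺ (All-map⁺ (All.universal (λ _ → Uniqueₚ.map⁺ ∷-injectiveˡ letters-unique) _))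
                                        (AllPairsₚ.map⁺ (AllPairs.map tails-differ (words-unique n k)))
  where
  letters-unique : Unique (applyUpTo suc n)
  letters-unique = Uniqueₚ.applyUpTo⁺₁ suc n (λ i<j _ → <⇒≢ (s<s i<j))
  tails-differ : ∀ {v v′} → v ≢ v′ → Disjoint (map (_∷ v) (applyUpTo suc n)) (map (_∷ v′) (applyUpTo suc n))
  tails-differ v≢v′ (u∈ , u∈′) with ∈-map⁻ (_∷ _) u∈ | ∈-map⁻ (_∷ _) u∈′
  ... | _ , _ , refl | _ , _ , eq = v≢v′ (∷-injectiveʳ eq)

∈-S⁻ : ∀ n {π} → π ∈ S n → Unique π × length π ≡ n × All (_∈ applyUpTo suc n) π
∈-S⁻ n π∈ with ∈-filter⁻ (λ w → T? (distinct w)) {xs = words n n} π∈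
... | π∈words , dist = distinct⇒Unique _ dist , ∈-words⁻ n n π∈words

∈-S⁺ : ∀ n {π} → Unique π → length π ≡ n → All (_∈ applyUpTo suc n) π → π ∈ S n
∈-S⁺ n {π} uπ len letters =
  ∈-filter⁺ (λ w → T? (distinct w)) (subst (λ k → π ∈ words n k) len (∈-words⁺ n letters)) (Unique⇒distinct π uπ)

S-unique : ∀ n → Unique (S n)
S-unique n = Uniqueₚ.filter⁺ (λ w → T? (distinct w)) (words-unique n n)

∈-S-resp-↭ : ∀ n {π π′} → π′ ↭ π → π ∈ S n → π′ ∈ S n
∈-S-resp-↭ n π′↭π π∈ with ∈-S⁻ n π∈
... | uπ , len , letters =
  ∈-S⁺ n (Unique-resp-↭ (↭-sym π′↭π) uπ) (trans (↭-length π′↭π) len) (All-resp-↭ (↭-sym π′↭π) letters)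

Avoiders : BarredPattern → ℕ → List (List ℕ)
Avoiders σ n = filter (λ π → T? (avoids σ π)) (S n)

Avoiders-unique : ∀ σ n → Unique (Avoiders σ n)
Avoiders-unique σ n = Uniqueₚ.filter⁺ (λ π → T? (avoids σ π)) (S-unique n)

∈-Avoiders⁻ : ∀ σ n {π} → π ∈ Avoiders σ n → Unique π × π ∈ S n × T (avoids σ π)
∈-Avoiders⁻ σ n π∈ =
  let π∈S , av = ∈-filter⁻ (λ π → T? (avoids σ π)) {xs = S n} π∈ in proj₁ (∈-S⁻ n π∈S) , π∈S , av

to23b154-∈ : ∀ n {π} → π ∈ Avoiders p25b134 n → to23b154 π ∈ Avoiders p23b154 n
to23b154-∈ n π∈ = let uπ , π∈S , av = ∈-Avoiders⁻ p25b134 n π∈ in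
  ∈-filter⁺ (λ π → T? (avoids p23b154 π)) (∈-S-resp-↭ n (to23b154-↭ uπ) π∈S) (to23b154-avoids uπ av)

to25b134-∈ : ∀ n {π} → π ∈ Avoiders p23b154 n → to25b134 π ∈ Avoiders p25b134 n
to25b134-∈ n π∈ = let uπ , π∈S , av = ∈-Avoiders⁻ p23b154 n π∈ in
  ∈-filter⁺ (λ π → T? (avoids p25b134 π)) (∈-S-resp-↭ n (to25b134-↭ uπ) π∈S) (to25b134-avoids uπ av)

corollary5p2 : (n : ℕ) → countAvoiders p25b134 n ≡ countAvoiders p23b154 n
corollary5p2 n = length-≡-by-inverses to23b154 to25b134
  (Avoiders-unique p25b134 n) (Avoiders-unique p23b154 n) (to23b154-∈ n) (to25b134-∈ n)
  (λ π∈ → let uπ , _ , av = ∈-Avoiders⁻ p25b134 n π∈ in to25b134∘to23b154 uπ av)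
  (λ π∈ → let uπ , _ , av = ∈-Avoiders⁻ p23b154 n π∈ in to23b154∘to25b134 uπ av)
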